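{- Let $\epsilon=\frac1{21}$ and $\delta=8\epsilon$. If $G$ is good, $R\subsetneq V(G)$, $|R|\ge 5$, and $R'$ is a critical extension of $R$, then $p_G(R)\ge p_G(R')+4-\delta+4\epsilon$. Furthermore $p_G(R')\ge p(G)$, and hence $p_G(R)\ge p(G)+4-\delta+4\epsilon$.
   Context: All graphs are finite and simple; $5$-critical means not $4$-colorable but every proper subgraph is $4$-colorable. An Ore-composition of $G_1,G_2$: delete an edge $xy$ of $G_1$, split a vertex $z$ of $G_2$ into two vertices of positive degree, identify them with $x,y$. $5$-Ore graphs are those obtained from copies of $K_5$ by repeated Ore-compositions. $T(G)$ is the maximum, over subgraphs $H$ of $G$ that are vertex-disjoint unions of cliques of size three or four, of (#$K_3$-components)$+2\cdot$(#$K_4$-components). Potential: $p(G)=(9+\epsilon)|V(G)|-4|E(G)|-\delta T(G)$, $p_G(R)=p(G[R])$. Let $P=6\delta$. A $5$-critical graph $G$ satisfies the Main Theorem if: $p(G)=5+5\epsilon-2\delta$ when $G=K_5$; $p(G)\le 5+|V(G)|\epsilon-(2+\frac{|V(G)|-1}{4})\delta$ when $G$ is $5$-Ore and $G\neq K_5$; $p(G)\le 5-P$ otherwise. A cluster is a maximal set of degree-four vertices with the same closed neighborhood. $H$ is smaller than $G$ if $|V(H)|<|V(G)|$, or $|V(H)|=|V(G)|$ and $|E(H)|>|E(G)|$, or $|V(H)|=|V(G)|$, $|E(H)|=|E(G)|$ and the sequence of cluster sizes of $H$ in decreasing order precedes that of $G$ lexicographically. A $5$-critical graph $G$ is good if every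 $5$-critical graph smaller than $G$ satisfies the Main Theorem. Critical extension: for $R\subsetneq V(G)$, $|R|\ge5$, and a $4$-coloring $\phi$ of $G[R]$, let $G_\phi(R)$ be obtained by identifying, for each color $i$, the vertices of $R$ colored $i$ into $x_i$, adding all edges $x_ix_j$, deleting parallel edges; for a $5$-critical subgraph $W$ of $G_\phi(R)$, $R'=(V(W)\setminus\{x_1,\dots,x_4\})\cup R$ is a critical extension of $R$ with extender $W$. -}

module Defs where

open import Data.Nat using (ℕ; zero; suc; _+_; _∸_; _<_; _≤_; _≡ᵇ_; _<ᵇ_)
open import Data.Nat.Properties using (≤-decTotalOrder)
open import Data.Bool using (Bool; true; false; _∧_; _∨_; not; if_then_else_)
open import Data.Fin using (Fin; zero; suc; splitAt; _↑ˡ_; toℕ; _≟_)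
open import Data.Sum using (_⊎_; inj₁; inj₂)
open import Data.Product using (Σ; _×_; _,_; ∃)
open import Data.List using (List; []; _∷_; length; map; concat; filterᵇ; reverse; allFin)
open import Data.List.Relation.Unary.All using (All)
open import Data.List.Relation.Unary.Unique.Propositional using (Unique)
open import Data.List.Membership.Propositional using (_∈_)
open import Data.List.Relation.Binary.Lex.Strict using (Lex-<)
open import Data.Integer using (+_)
open import Data.Rational using (ℚ; _/_; 1ℚ) renaming (_+_ to _+ℚ_; _*_ to _*ℚ_; _-_ to _-ℚ_; _≤_ to _≤ℚ_)
open import Relation.Nullary using (¬_)
open import Relation.Nullary.Decidable using (⌊_⌋)
open import Relation.Binary.PropositionalEquality using (_≡_; _≢_)
import Data.List.Sort
open import Data.Nat.ListAction using (sum)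

count : ∀ {n} → (Fin n → Bool) → ℕ
count {zero}  f = 0
count {suc n} f = (if f zero then 1 else 0) + count (λ i → f (suc i))

sumF : ∀ {n} → (Fin n → ℕ) → ℕ
sumF {zero}  f = 0
sumF {suc n} f = f zero + sumF (λ i → f (suc i))

anyF : ∀ {n} → (Fin n → Bool) → Bool
anyF {zero}  f = false
anyF {suc n} f = f zero ∨ anyF (λ i → f (suc i))

allF : ∀ {n} → (Fin n → Bool) → Bool
allF {zero}  f = true
allF {suc n} f = f zero ∧ allF (λ i → f (suc i))

_==_ : ∀ {n} → Fin n → Fin n → Bool
a == b = ⌊ a ≟ b ⌋

_==B_ : Bool → Bool → Bool
true  ==B b = b
false ==B b = not b

record Graph (n : ℕ) : Set where
  constructor mkGraph
  field
    V : Fin n → Bool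
    E : Fin n → Fin n → Bool
open Graph public

record IsGraph {n : ℕ} (G : Graph n) : Set where
  field
    sym  : ∀ i j → E G i j ≡ E G j i
    irr  : ∀ i → E G i i ≡ false
    inV  : ∀ i j → E G i j ≡ true → V G i ≡ true

nV : ∀ {n} → Graph n → ℕ
nV G = count (V G)

nE : ∀ {n} → Graph n → ℕ
nE {n} G = sumF (λ i → count (λ j → E G i j ∧ (toℕ i <ᵇ toℕ j)))

deg : ∀ {n} → Graph n → Fin n → ℕ
deg G v = count (E G v)

record Subgraph {n : ℕ} (H G : Graph n) : Set where
  field
    wf  : IsGraph H
    V⊆  : ∀ i → V H i ≡ true → V G i ≡ true
    E⊆  : ∀ i j → E H i j ≡ true → E G i j ≡ true

ProperSubgraph : ∀ {n} → Graph n → Graph n → Set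
ProperSubgraph H G = Subgraph H G ×
  ((Σ _ λ v → V G v ≡ true × V H v ≡ false) ⊎
   (Σ _ λ i → Σ _ λ j → E G i j ≡ true × E H i j ≡ false))

Coloring : ∀ {n} → Graph n → (k : ℕ) → (Fin n → Fin k) → Set
Coloring G k c = ∀ i j → E G i j ≡ true → c i ≢ c j

Colorable : ∀ {n} → Graph n → ℕ → Set
Colorable G k = Σ _ λ c → Coloring G k c

record Critical5 {n : ℕ} (G : Graph n) : Set where
  field
    not4col : ¬ Colorable G 4
    sub4col : ∀ H → ProperSubgraph H G → Colorable H 4

induced : ∀ {n} → Graph n → (Fin n → Bool) → Graph n
induced G R = mkGraph (λ i → V G i ∧ R i) (λ i j → E G i j ∧ R i ∧ R j)

record Iso {n m : ℕ} (G : Graph n) (H : Graph m) : Set where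
  field
    f  : Fin n → Fin m
    g  : Fin m → Fin n
    fV : ∀ i → V G i ≡ true → V H (f i) ≡ true
    gV : ∀ j → V H j ≡ true → V G (g j) ≡ true
    gf : ∀ i → V G i ≡ true → g (f i) ≡ i
    fg : ∀ j → V H j ≡ true → f (g j) ≡ j
    fE : ∀ i j → V G i ≡ true → V G j ≡ true → E H (f i) (f j) ≡ E G i j

K5 : Graph 5
K5 = mkGraph (λ _ → true) (λ i j → not (i == j))

-- Ore-composition of G1, G2: delete the edge xy of G1, split z of G2 into
-- z₁ (adjacent to the neighbours b of z with side b = true) and z₂ (the
-- others), identify z₁ with x and z₂ with y.  Vertices of G1 are the
-- first n1 labels, those of G2 - z the last n2 labels.
oreGraph : ∀ {n1 n2} → Graph n1 → Graph n2 →
           (x y : Fin n1) (z : Fin n2) (side : Fin n2 → Bool) → Graph (n1 + n2)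
oreGraph {n1} {n2} G1 G2 x y z side = mkGraph oV oE
  where
  oV : Fin (n1 + n2) → Bool
  oV k with splitAt n1 k
  ... | inj₁ a = V G1 a
  ... | inj₂ b = V G2 b ∧ not (b == z)
  cross : Fin n1 → Fin n2 → Bool
  cross a b = not (b == z) ∧ E G2 z b ∧ ((a == x ∧ side b) ∨ (a == y ∧ not (side b)))
  e : Fin n1 ⊎ Fin n2 → Fin n1 ⊎ Fin n2 → Bool
  e (inj₁ a) (inj₁ b) = E G1 a b ∧ not ((a == x ∧ b == y) ∨ (a == y ∧ b == x))
  e (inj₂ a) (inj₂ b) = E G2 a b ∧ not (a == z) ∧ not (b == z)
  e (inj₁ a) (inj₂ b) = cross a b
  e (inj₂ b) (inj₁ a) = cross a b
  oE : Fin (n1 + n2) → Fin (n1 + n2) → Bool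
  oE k l = e (splitAt n1 k) (splitAt n1 l)

record OreData {n1 n2 : ℕ} (G1 : Graph n1) (G2 : Graph n2) : Set where
  field
    x y  : Fin n1
    xy   : E G1 x y ≡ true
    z    : Fin n2
    zV   : V G2 z ≡ true
    side : Fin n2 → Bool
    pos₁ : Σ _ λ b → E G2 z b ≡ true × side b ≡ true
    pos₂ : Σ _ λ b → E G2 z b ≡ true × side b ≡ false

data Ore5 : ∀ {n} → Graph n → Set where
  base : ∀ {n} {G : Graph n} → Iso G K5 → Ore5 G
  comp : ∀ {n n1 n2} {G : Graph n} {G1 : Graph n1} {G2 : Graph n2} →
         IsGraph G1 → IsGraph G2 → Ore5 G1 → Ore5 G2 →
         (d : OreData G1 G2) →
         Iso G (oreGraph G1 G2 (OreData.x d) (OreData.y d) (OreData.z d) (OreData.side d)) →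
         Ore5 G

IsClique34 : ∀ {n} → Graph n → List (Fin n) → Set
IsClique34 G P = (length P ≡ 3 ⊎ length P ≡ 4) × All (λ u → V G u ≡ true) P ×
                 (∀ u v → u ∈ P → v ∈ P → u ≢ v → E G u v ≡ true)

record Packing {n : ℕ} (G : Graph n) : Set where
  field
    parts    : List (List (Fin n))
    disjoint : Unique (concat parts)
    cliques  : All (IsClique34 G) parts

-- (#K3-components) + 2·(#K4-components)
packValue : ∀ {n} {G : Graph n} → Packing G → ℕ
packValue P = sum (map (λ Q → length Q ∸ 2) (Packing.parts P))

IsT : ∀ {n} → Graph n → ℕ → Set
IsT G t = (Σ (Packing G) λ P → packValue P ≡ t) × (∀ (P : Packing G) → packValue P ≤ t)

ℕtoℚ : ℕ → ℚ
ℕtoℚ k = + k / 1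

ε δ Pc : ℚ
ε = + 1 / 21
δ = + 8 / 21
Pc = ℕtoℚ 6 *ℚ δ

pot : ∀ {n} → Graph n → ℕ → ℚ
pot G t = ((ℕtoℚ 9 +ℚ ε) *ℚ ℕtoℚ (nV G) -ℚ ℕtoℚ 4 *ℚ ℕtoℚ (nE G)) -ℚ δ *ℚ ℕtoℚ t

MainThm : ∀ {n} → Graph n → Set
MainThm G = ∀ t → IsT G t →
  (Iso G K5 → pot G t ≡ (ℕtoℚ 5 +ℚ ℕtoℚ 5 *ℚ ε) -ℚ ℕtoℚ 2 *ℚ δ) ×
  (Ore5 G → ¬ Iso G K5 →
     pot G t ≤ℚ (ℕtoℚ 5 +ℚ ℕtoℚ (nV G) *ℚ ε)
                -ℚ (ℕtoℚ 2 +ℚ (ℕtoℚ (nV G) -ℚ 1ℚ) *ℚ (+ 1 / 4)) *ℚ δ) ×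
  (¬ Ore5 G → pot G t ≤ℚ ℕtoℚ 5 -ℚ Pc)

sameCluster : ∀ {n} → Graph n → Fin n → Fin n → Bool
sameCluster G u v = (deg G u ≡ᵇ 4) ∧ (deg G v ≡ᵇ 4) ∧
  allF (λ w → ((w == u) ∨ E G u w) ==B ((w == v) ∨ E G v w))

clusterSize : ∀ {n} → Graph n → Fin n → ℕ
clusterSize G v = count (λ u → sameCluster G u v)

isRep : ∀ {n} → Graph n → Fin n → Bool
isRep G v = (deg G v ≡ᵇ 4) ∧ not (anyF (λ u → (toℕ u <ᵇ toℕ v) ∧ sameCluster G u v))

open module NatSort = Data.List.Sort ≤-decTotalOrder using (sort)

clusterSeq : ∀ {n} → Graph n → List ℕ
clusterSeq {n} G = reverse (sort (map (clusterSize G) (filterᵇ (isRep G) (allFin n))))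

Smaller : ∀ {m n} → Graph m → Graph n → Set
Smaller H G = nV H < nV G ⊎ (nV H ≡ nV G × nE G < nE H) ⊎
  (nV H ≡ nV G × nE H ≡ nE G × Lex-< _≡_ _<_ (clusterSeq H) (clusterSeq G))

Good : ∀ {n} → Graph n → Set
Good G = Critical5 G × (∀ m (H : Graph m) → IsGraph H → Critical5 H → Smaller H G → MainThm H)

-- G_φ(R): vertices of V(G) - R keep labels in the first n, x₁..x₄ are the last 4
Gφ : ∀ {n} → Graph n → (Fin n → Bool) → (Fin n → Fin 4) → Graph (n + 4)
Gφ {n} G R φ = mkGraph gV gE
  where
  gV : Fin (n + 4) → Bool
  gV k with splitAt n k
  ... | inj₁ a = V G a ∧ not (R a)
  ... | inj₂ i = true
  cross : Fin n → Fin 4 → Bool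
  cross a i = not (R a) ∧ anyF (λ r → R r ∧ (φ r == i) ∧ E G a r)
  e : Fin n ⊎ Fin 4 → Fin n ⊎ Fin 4 → Bool
  e (inj₁ a) (inj₁ b) = E G a b ∧ not (R a) ∧ not (R b)
  e (inj₁ a) (inj₂ i) = cross a i
  e (inj₂ i) (inj₁ a) = cross a i
  e (inj₂ i) (inj₂ j) = not (i == j)
  gE : Fin (n + 4) → Fin (n + 4) → Bool
  gE k l = e (splitAt n k) (splitAt n l)

-- R' = (V(W) - {x₁..x₄}) ∪ R, as a subset of Fin n
extSet : ∀ {n} → (Fin n → Bool) → Graph (n + 4) → Fin n → Bool
extSet {n} R W a = R a ∨ V W (a ↑ˡ 4)

CriticalExtension : ∀ {n} → Graph n → (Fin n → Bool) → (Fin n → Bool) → Set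
CriticalExtension {n} G R R' =
  Σ (Fin n → Fin 4) λ φ → Coloring (induced G R) 4 φ ×
  Σ (Graph (n + 4)) λ W → Subgraph W (Gφ G R φ) × Critical5 W ×
  (∀ a → R' a ≡ extSet R W a)

-- Multiplying by 21, p = (190|V| − 84|E| − 8T)/21, so every claim becomes an inequality between natural
-- numbers.  Let W be the extender of R′ = R ∪ O, where O are the original vertices of W and X ⊆ {x₁,…,x₄} the
-- identified ones.  Then |R′| = |R| + |O| and |W| = |O| + |X|.  An edge of W from v ∈ O to xᵢ comes from an edge
-- of G from v to a vertex of R of colour i, so e(R) + e(W) ≤ e(R′) + e(K_|X|); an optimal packing of G[R] together
-- with the parts of an optimal packing of W that avoid X is a packing of G[R′], so T(R) + T(W) ≤ T(R′) + 2|X|.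
-- W is smaller than G, so the Main Theorem gives 21·p(W) ≤ 94, and X ≠ ∅ because otherwise W would be a proper
-- subgraph of G.  Together these give p_G(R) − p_G(R′) ≥ 80/21 = 4 − δ + 4ε.
-- For p_G(R′) ≥ p(G), keep replacing S by a critical extension of it (one exists while S ≠ V(G), since G[S] is
-- then 4-colourable, and it strictly enlarges S) until S = V(G); the potential never increases on the way.
-- T-values and critical subgraphs are only shown to exist classically, which suffices since every conclusion is
-- a decidable inequality.

module Submission where

open import Defs
open import Data.Nat using (ℕ; zero; suc; _+_; _*_; _∸_; _≤_; _<_; z≤n; s≤s; _<ᵇ_)
open import Data.Nat.Properties hiding (_≟_)
open import Algebra.Properties.CommutativeSemigroup +-commutativeSemigroup using () renaming (interchange to +-interchange)
import Data.Nat.Solver as ℕ-Solver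
open import Data.Nat.ListAction using (sum)
open import Data.Nat.ListAction.Properties using (sum-++)
open import Data.Nat.Coprimality using (1-coprimeTo) renaming (sym to coprime-sym)
import Data.Integer as ℤ
open import Data.Rational as ℚ using (ℚ; toℚᵘ; 1ℚ; 0ℚ; NonNegative)
  renaming (_+_ to _+ℚ_; _*_ to _*ℚ_; _-_ to _-ℚ_; _≤_ to _≤ℚ_)
import Data.Rational.Properties as ℚ
import Data.Rational.Solver as ℚ-Solver
open import Data.Rational.Unnormalised as ℚᵘ using (ℚᵘ; mkℚᵘ; _≃_; *≡*; *≤*)
import Data.Rational.Unnormalised.Properties as ℚᵘ
open import Data.Bool using (Bool; true; false; _∧_; _∨_; not; if_then_else_; T)
open import Data.Bool.Properties using (∧-identityʳ; ∧-zeroʳ; ∧-comm; ∨-zeroʳ)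
import Data.Bool.Properties as Bool
open import Data.Fin using (Fin; zero; suc; _↑ˡ_; _↑ʳ_; toℕ; _≟_; splitAt)
open import Data.Fin.Properties using (splitAt-↑ˡ; splitAt-↑ʳ; splitAt⁻¹-↑ˡ; splitAt⁻¹-↑ʳ; ↑ˡ-injective; toℕ-injective)
import Data.Fin.Properties as Fin
import Data.Vec.Functional as Vector
open import Data.List using (List; []; _∷_; _++_; map; length; concat)
import Data.List.Properties as List
open import Data.List.Relation.Unary.All using (All; []; _∷_)
import Data.List.Relation.Unary.All as All
import Data.List.Relation.Unary.All.Properties as All
open import Data.List.Relation.Unary.AllPairs using ([]; _∷_)
open import Data.List.Relation.Unary.Any using (here; there)
open import Data.List.Relation.Unary.Unique.Propositional using (Unique)
import Data.List.Relation.Unary.Unique.Propositional.Properties as Unique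
open import Data.List.Membership.Propositional using (_∈_)
import Data.List.Membership.Propositional.Properties as ∈
open import Data.Product using (Σ; _×_; _,_; proj₁; proj₂)
open import Data.Sum using (_⊎_; inj₁; inj₂; [_,_]′)
open import Data.Empty using (⊥; ⊥-elim)
open import Data.Unit using (tt)
open import Function using (case_of_; _$_)
open import Level using (0ℓ)
open import Effect.Monad using (RawMonad)
open import Relation.Nullary using (¬_; Dec; yes; no)
open import Relation.Nullary.Decidable using (True; map′; toWitness; decidable-stable; ¬¬-excluded-middle; ¬?; _→-dec_)
open import Relation.Nullary.Negation using (¬¬-Monad)
open import Relation.Binary.PropositionalEquality

open RawMonad (¬¬-Monad {a = 0ℓ}) using (pure; _>>=_)

-- Counting over Fin n

χ : Bool → ℕ
χ b = if b then 1 else 0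

χ≤1 : ∀ b → χ b ≤ 1
χ≤1 true  = ≤-refl
χ≤1 false = z≤n

χ-mono : ∀ {a b} → (a ≡ true → b ≡ true) → χ a ≤ χ b
χ-mono {false} _ = z≤n
χ-mono {true}  h rewrite h refl = ≤-refl

χ-∧ˡ : ∀ a b → χ (a ∧ b) ≤ χ b
χ-∧ˡ true  b = ≤-refl
χ-∧ˡ false b = z≤n

χ-∨ : ∀ a b → a ∧ b ≡ false → χ (a ∨ b) ≡ χ a + χ b
χ-∨ false b    _ = refl
χ-∨ true false _ = refl

count≡sumF : ∀ {n} (f : Fin n → Bool) → count f ≡ sumF (λ i → χ (f i))
count≡sumF {zero}  f = refl
count≡sumF {suc n} f = cong (χ (f zero) +_) (count≡sumF (λ i → f (suc i)))

sumF-cong : ∀ {n} {f g : Fin n → ℕ} → (∀ i → f i ≡ g i) → sumF f ≡ sumF g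
sumF-cong {zero}  h = refl
sumF-cong {suc n} h = cong₂ _+_ (h zero) (sumF-cong (λ i → h (suc i)))

sumF-mono : ∀ {n} {f g : Fin n → ℕ} → (∀ i → f i ≤ g i) → sumF f ≤ sumF g
sumF-mono {zero}  h = z≤n
sumF-mono {suc n} h = +-mono-≤ (h zero) (sumF-mono (λ i → h (suc i)))

sumF-mono-< : ∀ {n} {f g : Fin n → ℕ} → (∀ i → f i ≤ g i) → ∀ i → f i < g i → sumF f < sumF g
sumF-mono-< {suc n} h zero    lt = +-mono-<-≤ lt (sumF-mono (λ i → h (suc i)))
sumF-mono-< {suc n} h (suc i) lt = +-mono-≤-< (h zero) (sumF-mono-< (λ i → h (suc i)) i lt)

sumF-zero : ∀ {n} (f : Fin n → ℕ) → (∀ i → f i ≡ 0) → sumF f ≡ 0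
sumF-zero {zero}  f h = refl
sumF-zero {suc n} f h rewrite h zero = sumF-zero (λ i → f (suc i)) (λ i → h (suc i))

sumF-distrib-+ : ∀ {n} (f g : Fin n → ℕ) → sumF (λ i → f i + g i) ≡ sumF f + sumF g
sumF-distrib-+ {zero}  f g = refl
sumF-distrib-+ {suc n} f g = trans
  (cong (f zero + g zero +_) (sumF-distrib-+ (λ i → f (suc i)) (λ i → g (suc i))))
  (+-interchange (f zero) (g zero) (sumF (λ i → f (suc i))) (sumF (λ i → g (suc i))))

sumF₂ : ∀ {m n} → (Fin m → Fin n → ℕ) → ℕ
sumF₂ f = sumF (λ i → sumF (f i))

sumF₂-transpose : ∀ {m n} (f : Fin m → Fin n → ℕ) → sumF₂ f ≡ sumF₂ (λ j i → f i j)
sumF₂-transpose {zero}  {n} f = sym (sumF-zero {n} (λ _ → 0) (λ _ → refl))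
sumF₂-transpose {suc m} {n} f = trans (cong (sumF (f zero) +_) (sumF₂-transpose (λ i → f (suc i))))
  (sym (sumF-distrib-+ (f zero) (λ j → sumF (λ i → f (suc i) j))))

sumF-↑ : ∀ {m} k (f : Fin (m + k) → ℕ) →
         sumF f ≡ sumF (λ a → f (a ↑ˡ k)) + sumF (λ i → f (m ↑ʳ i))
sumF-↑ {zero}  k f = refl
sumF-↑ {suc m} k f = trans (cong (f zero +_) (sumF-↑ k (λ i → f (suc i))))
  (sym (+-assoc (f zero) _ _))

count-cong : ∀ {n} {f g : Fin n → Bool} → (∀ i → f i ≡ g i) → count f ≡ count g
count-cong {f = f} {g} h =
  trans (count≡sumF f) (trans (sumF-cong (λ i → cong χ (h i))) (sym (count≡sumF g)))

count-mono : ∀ {n} {f g : Fin n → Bool} → (∀ i → f i ≡ true → g i ≡ true) → count f ≤ count g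
count-mono {f = f} {g} h = subst₂ _≤_ (sym (count≡sumF f)) (sym (count≡sumF g))
  (sumF-mono (λ i → χ-mono (h i)))

count-mono-< : ∀ {n} {f g : Fin n → Bool} → (∀ i → f i ≡ true → g i ≡ true) →
               ∀ i → f i ≡ false → g i ≡ true → count f < count g
count-mono-< {f = f} {g} h i fi gi = subst₂ _<_ (sym (count≡sumF f)) (sym (count≡sumF g))
  (sumF-mono-< (λ j → χ-mono (h j)) i (subst₂ _<_ (cong χ (sym fi)) (cong χ (sym gi)) ≤-refl))

count-↑ : ∀ {m} k (f : Fin (m + k) → Bool) →
          count f ≡ count (λ a → f (a ↑ˡ k)) + count (λ i → f (m ↑ʳ i))
count-↑ {m} k f = trans (count≡sumF f) (trans (sumF-↑ k (λ i → χ (f i)))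
  (sym (cong₂ _+_ (count≡sumF (λ a → f (a ↑ˡ k))) (count≡sumF (λ i → f (m ↑ʳ i))))))

count≤n : ∀ {n} (f : Fin n → Bool) → count f ≤ n
count≤n {zero}  f = z≤n
count≤n {suc n} f = +-mono-≤ (χ≤1 (f zero)) (count≤n (λ i → f (suc i)))

count-zero : ∀ {n} (f : Fin n → Bool) → (∀ i → f i ≡ false) → count f ≡ 0
count-zero f h = trans (count≡sumF f) (sumF-zero _ (λ i → cong χ (h i)))

count-∨ : ∀ {n} (f g : Fin n → Bool) → (∀ i → f i ∧ g i ≡ false) →
          count (λ i → f i ∨ g i) ≡ count f + count g
count-∨ f g h = begin
  count (λ i → f i ∨ g i)              ≡⟨ count≡sumF (λ i → f i ∨ g i) ⟩
  sumF (λ i → χ (f i ∨ g i))           ≡⟨ sumF-cong (λ i → χ-∨ (f i) (g i) (h i)) ⟩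
  sumF (λ i → χ (f i) + χ (g i))       ≡⟨ sumF-distrib-+ (λ i → χ (f i)) (λ i → χ (g i)) ⟩
  sumF (λ i → χ (f i)) + sumF (λ i → χ (g i)) ≡⟨ sym (cong₂ _+_ (count≡sumF f) (count≡sumF g)) ⟩
  count f + count g                    ∎
  where open ≡-Reasoning

==-refl : ∀ {n} (x : Fin n) → (x == x) ≡ true
==-refl x with x ≟ x
... | yes _  = refl
... | no x≢x = ⊥-elim (x≢x refl)

==-≢ : ∀ {n} {x y : Fin n} → x ≢ y → (x == y) ≡ false
==-≢ {x = x} {y} x≢y with x ≟ y
... | yes x≡y = ⊥-elim (x≢y x≡y)
... | no _    = refl

==-sym : ∀ {n} (x y : Fin n) → (x == y) ≡ (y == x)
==-sym x y with x ≟ y | y ≟ x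
... | yes _ | yes _ = refl
... | no _  | no _  = refl
... | yes e | no ne = ⊥-elim (ne (sym e))
... | no ne | yes e = ⊥-elim (ne (sym e))

==-suc : ∀ {n} (x y : Fin n) → (suc x == suc y) ≡ (x == y)
==-suc x y with x ≟ y | suc x ≟ suc y
... | yes _ | yes _ = refl
... | no _  | no _  = refl
... | yes e | no ne = ⊥-elim (ne (cong suc e))
... | no ne | yes e = ⊥-elim (ne (Fin.suc-injective e))

count-remove : ∀ {n} (f : Fin n → Bool) x → f x ≡ true →
               count f ≡ suc (count (λ y → f y ∧ not (y == x)))
count-remove {suc n} f zero fx rewrite fx = cong suc (count-cong keep-suc)
  where
  keep-suc : ∀ i → f (suc i) ≡ f (suc i) ∧ not (suc i == zero)
  keep-suc i rewrite ==-≢ {x = suc i} {y = zero} (λ ()) with f (suc i)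
  ... | true  = refl
  ... | false = refl
count-remove {suc n} f (suc x) fx
  with trans (count-remove (λ i → f (suc i)) x fx)
             (cong suc (count-cong (λ i → cong (λ b → f (suc i) ∧ not b) (sym (==-suc i x)))))
     | f zero
... | eq | true  = cong suc eq
... | eq | false = eq

anyF-witness : ∀ {n} (f : Fin n → Bool) → anyF f ≡ true → Σ (Fin n) λ i → f i ≡ true
anyF-witness {suc n} f h with f zero in f0
... | true  = zero , f0
... | false = let (i , fi) = anyF-witness (λ i → f (suc i)) h in suc i , fi

anyF-intro : ∀ {n} (f : Fin n → Bool) i → f i ≡ true → anyF f ≡ true
anyF-intro f zero    h rewrite h = refl
anyF-intro f (suc i) h with f zero
... | true  = refl
... | false = anyF-intro (λ i → f (suc i)) i h

anyF-false : ∀ {n} (f : Fin n → Bool) → anyF f ≡ false → ∀ i → f i ≡ false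
anyF-false f h i with f i in fi
... | false = refl
... | true with trans (sym (anyF-intro f i fi)) h
... | ()

χ-anyF≤count : ∀ {n} (f : Fin n → Bool) → χ (anyF f) ≤ count f
χ-anyF≤count f with anyF f in h
... | false = z≤n
... | true  = let (i , fi) = anyF-witness f h in
  subst (1 ≤_) (sym (count-remove f i fi)) (s≤s z≤n)

count-positive : ∀ {n} (f : Fin n → Bool) → 1 ≤ count f → Σ (Fin n) λ i → f i ≡ true
count-positive f h with anyF f in any-f
... | true  = anyF-witness f any-f
... | false with subst (1 ≤_) (count-zero f (anyF-false f any-f)) h
... | ()

not-==⇒≢ : ∀ {n} {x y : Fin n} → not (x == y) ≡ true → x ≢ y
not-==⇒≢ {x = x} h refl rewrite ==-refl x with h
... | ()

sumF₂-cong : ∀ {m n} {f g : Fin m → Fin n → ℕ} → (∀ i j → f i j ≡ g i j) → sumF₂ f ≡ sumF₂ g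
sumF₂-cong h = sumF-cong (λ i → sumF-cong (h i))

sumF₂-mono : ∀ {m n} {f g : Fin m → Fin n → ℕ} → (∀ i j → f i j ≤ g i j) → sumF₂ f ≤ sumF₂ g
sumF₂-mono h = sumF-mono (λ i → sumF-mono (h i))

sumF₂-distrib-+ : ∀ {m n} (f g : Fin m → Fin n → ℕ) →
                  sumF₂ (λ i j → f i j + g i j) ≡ sumF₂ f + sumF₂ g
sumF₂-distrib-+ f g = trans (sumF-cong (λ i → sumF-distrib-+ (f i) (g i)))
  (sumF-distrib-+ (λ i → sumF (f i)) (λ i → sumF (g i)))

sumF₂-↑ : ∀ {m} k (f : Fin (m + k) → Fin (m + k) → ℕ) →
          sumF₂ f ≡ (sumF₂ (λ a b → f (a ↑ˡ k) (b ↑ˡ k)) + sumF₂ (λ a j → f (a ↑ˡ k) (m ↑ʳ j)))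
                  + (sumF₂ (λ i b → f (m ↑ʳ i) (b ↑ˡ k)) + sumF₂ (λ i j → f (m ↑ʳ i) (m ↑ʳ j)))
sumF₂-↑ {m} k f = begin
  sumF₂ f
    ≡⟨ sumF-↑ k (λ p → sumF (f p)) ⟩
  sumF (λ a → sumF (f (a ↑ˡ k))) + sumF (λ i → sumF (f (m ↑ʳ i)))
    ≡⟨ cong₂ _+_ (sumF-cong (λ a → sumF-↑ k (f (a ↑ˡ k)))) (sumF-cong (λ i → sumF-↑ k (f (m ↑ʳ i)))) ⟩
  sumF (λ a → sumF (λ b → f (a ↑ˡ k) (b ↑ˡ k)) + sumF (λ j → f (a ↑ˡ k) (m ↑ʳ j)))
    + sumF (λ i → sumF (λ b → f (m ↑ʳ i) (b ↑ˡ k)) + sumF (λ j → f (m ↑ʳ i) (m ↑ʳ j)))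
    ≡⟨ cong₂ _+_ (sumF-distrib-+ (λ a → sumF (λ b → f (a ↑ˡ k) (b ↑ˡ k))) (λ a → sumF (λ j → f (a ↑ˡ k) (m ↑ʳ j))))
                 (sumF-distrib-+ (λ i → sumF (λ b → f (m ↑ʳ i) (b ↑ˡ k))) (λ i → sumF (λ j → f (m ↑ʳ i) (m ↑ʳ j)))) ⟩
  (sumF₂ (λ a b → f (a ↑ˡ k) (b ↑ˡ k)) + sumF₂ (λ a j → f (a ↑ˡ k) (m ↑ʳ j)))
    + (sumF₂ (λ i b → f (m ↑ʳ i) (b ↑ˡ k)) + sumF₂ (λ i j → f (m ↑ʳ i) (m ↑ʳ j))) ∎
  where open ≡-Reasoning

sumF-χ-==ʳ : ∀ {k} (x : Fin k) b → sumF (λ i → χ (b ∧ (x == i))) ≡ χ b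
sumF-χ-==ʳ {suc k} zero b = trans (cong₂ _+_ (cong χ (∧-identityʳ b))
  (sumF-zero {k} _ (λ i → cong χ (trans (cong (b ∧_) (==-≢ {x = zero} {suc i} (λ ()))) (∧-zeroʳ b)))))
  (+-identityʳ (χ b))
sumF-χ-==ʳ {suc k} (suc x) b = begin
  χ (b ∧ (suc x == zero)) + sumF (λ i → χ (b ∧ (suc x == suc i)))
    ≡⟨ cong₂ _+_ (cong χ (trans (cong (b ∧_) (==-≢ {x = suc x} {zero} (λ ()))) (∧-zeroʳ b)))
                 (sumF-cong (λ i → cong (λ c → χ (b ∧ c)) (==-suc x i))) ⟩
  sumF (λ i → χ (b ∧ (x == i)))
    ≡⟨ sumF-χ-==ʳ x b ⟩
  χ b ∎
  where open ≡-Reasoning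

χ-∧-∨∨ : ∀ e r s r′ s′ → r ∧ s ≡ false → r′ ∧ s′ ≡ false →
         χ (e ∧ (r ∨ s) ∧ (r′ ∨ s′)) ≡ χ (e ∧ r ∧ r′) + χ (e ∧ s ∧ s′) + χ (e ∧ s ∧ r′) + χ (e ∧ r ∧ s′)
χ-∧-∨∨ false _     _     _     _     _  _  = refl
χ-∧-∨∨ true  true  true  _     _     () _
χ-∧-∨∨ true  _     _     true  true  _  ()
χ-∧-∨∨ true  true  false true  false _  _  = refl
χ-∧-∨∨ true  true  false false true  _  _  = refl
χ-∧-∨∨ true  true  false false false _  _  = refl
χ-∧-∨∨ true  false true  true  false _  _  = refl
χ-∧-∨∨ true  false true  false true  _  _  = refl
χ-∧-∨∨ true  false true  false false _  _  = refl
χ-∧-∨∨ true  false false true  false _  _  = refl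
χ-∧-∨∨ true  false false false true  _  _  = refl
χ-∧-∨∨ true  false false false false _  _  = refl

orderedPairs : ∀ {k} → (Fin k → Bool) → ℕ
orderedPairs f = sumF₂ (λ i j → χ (f i ∧ f j ∧ not (i == j)))

-- Edge counts and subgraphs

∧-intro : ∀ {a b} → a ≡ true → b ≡ true → a ∧ b ≡ true
∧-intro refl refl = refl

∧-elimˡ : ∀ {a b} → a ∧ b ≡ true → a ≡ true
∧-elimˡ {true} _ = refl

∧-elimʳ : ∀ {a b} → a ∧ b ≡ true → b ≡ true
∧-elimʳ {true} h = h

not≡true⇒≡false : ∀ {b} → not b ≡ true → b ≡ false
not≡true⇒≡false {false} _ = refl

<ᵇ-true⇒< : ∀ {m n} → (m <ᵇ n) ≡ true → m < n
<ᵇ-true⇒< {m} {n} h = <ᵇ⇒< m n (subst T (sym h) tt)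

<ᵇ-false⇒≥ : ∀ {m n} → (m <ᵇ n) ≡ false → n ≤ m
<ᵇ-false⇒≥ {m} {n} h = ≮⇒≥ (λ m<n → subst T h (<⇒<ᵇ m<n))

unordered⇒≡ : ∀ {n} {i j : Fin n} → (toℕ i <ᵇ toℕ j) ≡ false → (toℕ j <ᵇ toℕ i) ≡ false → i ≡ j
unordered⇒≡ {i = i} {j} i≮j j≮i =
  toℕ-injective (≤-antisym (<ᵇ-false⇒≥ {toℕ j} j≮i) (<ᵇ-false⇒≥ {toℕ i} i≮j))

module _ {n} {G : Graph n} (g : IsGraph G) where

  edge-≢ : ∀ {i j} → E G i j ≡ true → i ≢ j
  edge-≢ {i} e refl with trans (sym e) (IsGraph.irr g i)
  ... | ()

  edge-inVʳ : ∀ {i j} → E G i j ≡ true → V G j ≡ true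
  edge-inVʳ {i} {j} e = IsGraph.inV g j i (trans (IsGraph.sym g j i) e)

  edge-orientation : ∀ {i j} → E G i j ≡ true →
                     (toℕ i <ᵇ toℕ j) ≡ true ⊎ (toℕ j <ᵇ toℕ i) ≡ true
  edge-orientation {i} {j} e with toℕ i <ᵇ toℕ j in i<j | toℕ j <ᵇ toℕ i in j<i
  ... | true  | _     = inj₁ refl
  ... | false | true  = inj₂ refl
  ... | false | false = ⊥-elim (edge-≢ e (unordered⇒≡ i<j j<i))

  χ-edge-orient : ∀ i j → χ (E G i j) ≡
                  χ (E G i j ∧ (toℕ i <ᵇ toℕ j)) + χ (E G j i ∧ (toℕ j <ᵇ toℕ i))
  χ-edge-orient i j rewrite IsGraph.sym g j i with E G i j in e
  ... | false = refl
  ... | true with toℕ i <ᵇ toℕ j in i<j | toℕ j <ᵇ toℕ i in j<i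
  ... | true  | true  = ⊥-elim (<-asym (<ᵇ-true⇒< {toℕ i} i<j) (<ᵇ-true⇒< {toℕ j} j<i))
  ... | true  | false = refl
  ... | false | true  = refl
  ... | false | false = ⊥-elim (edge-≢ e (unordered⇒≡ i<j j<i))

arcs : ∀ {n} → Graph n → ℕ
arcs G = sumF₂ (λ i j → χ (E G i j))

arcs≡nE+nE : ∀ {n} {G : Graph n} → IsGraph G → arcs G ≡ nE G + nE G
arcs≡nE+nE {n} {G} g = begin
  arcs G
    ≡⟨ sumF-cong (λ i → sumF-cong (χ-edge-orient g i)) ⟩
  sumF (λ i → sumF (λ j → up i j + up j i))
    ≡⟨ sumF-cong (λ i → sumF-distrib-+ (up i) (λ j → up j i)) ⟩
  sumF (λ i → sumF (up i) + sumF (λ j → up j i))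
    ≡⟨ sumF-distrib-+ (λ i → sumF (up i)) (λ i → sumF (λ j → up j i)) ⟩
  sumF (λ i → sumF (up i)) + sumF (λ i → sumF (λ j → up j i))
    ≡⟨ cong (sumF (λ i → sumF (up i)) +_) (sumF₂-transpose (λ i j → up j i)) ⟩
  sumF (λ i → sumF (up i)) + sumF (λ i → sumF (up i))
    ≡⟨ sym (cong₂ _+_ nE≡ nE≡) ⟩
  nE G + nE G ∎
  where
  open ≡-Reasoning
  up : Fin n → Fin n → ℕ
  up i j = χ (E G i j ∧ (toℕ i <ᵇ toℕ j))
  nE≡ : nE G ≡ sumF (λ i → sumF (up i))
  nE≡ = sumF-cong (λ i → count≡sumF (λ j → E G i j ∧ (toℕ i <ᵇ toℕ j)))

induced-isGraph : ∀ {n} {G : Graph n} (S : Fin n → Bool) → IsGraph G → IsGraph (induced G S)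
induced-isGraph {G = G} S g = record { sym = symmetric ; irr = irreflexive ; inV = incident }
  where
  symmetric : ∀ i j → (E G i j ∧ S i ∧ S j) ≡ (E G j i ∧ S j ∧ S i)
  symmetric i j rewrite IsGraph.sym g i j with S i | S j
  ... | true  | true  = refl
  ... | true  | false = refl
  ... | false | true  = refl
  ... | false | false = refl
  irreflexive : ∀ i → (E G i i ∧ S i ∧ S i) ≡ false
  irreflexive i rewrite IsGraph.irr g i = refl
  incident : ∀ i j → (E G i j ∧ S i ∧ S j) ≡ true → (V G i ∧ S i) ≡ true
  incident i j h = ∧-intro (IsGraph.inV g i j (∧-elimˡ h)) (∧-elimˡ (∧-elimʳ {E G i j} h))

⊆-refl : ∀ {n} {G : Graph n} → IsGraph G → Subgraph G G
⊆-refl g = record { wf = g ; V⊆ = λ _ h → h ; E⊆ = λ _ _ h → h }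

⊆-trans : ∀ {n} {A B C : Graph n} → Subgraph A B → Subgraph B C → Subgraph A C
⊆-trans A⊆B B⊆C = record
  { wf = Subgraph.wf A⊆B
  ; V⊆ = λ i h → Subgraph.V⊆ B⊆C i (Subgraph.V⊆ A⊆B i h)
  ; E⊆ = λ i j h → Subgraph.E⊆ B⊆C i j (Subgraph.E⊆ A⊆B i j h) }

module _ {n} {H G : Graph n} (E⊆ : ∀ i j → E H i j ≡ true → E G i j ≡ true) where

  private
    oriented⊆ : ∀ i j → (E H i j ∧ (toℕ i <ᵇ toℕ j)) ≡ true → (E G i j ∧ (toℕ i <ᵇ toℕ j)) ≡ true
    oriented⊆ i j h = ∧-intro (E⊆ i j (∧-elimˡ h)) (∧-elimʳ {E H i j} h)

  nE-mono : nE H ≤ nE G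
  nE-mono = sumF-mono (λ i → count-mono (oriented⊆ i))

  nE-mono-< : IsGraph H → IsGraph G → ∀ i j → E G i j ≡ true → E H i j ≡ false → nE H < nE G
  nE-mono-< h g i j eG eH with edge-orientation g eG
  ... | inj₁ i<j = sumF-mono-< (λ k → count-mono (oriented⊆ k)) i
          (count-mono-< (oriented⊆ i) j (cong (_∧ _) eH) (∧-intro eG i<j))
  ... | inj₂ j<i = sumF-mono-< (λ k → count-mono (oriented⊆ k)) j
          (count-mono-< (oriented⊆ j) i (cong (_∧ _) (trans (IsGraph.sym h j i) eH))
                                        (∧-intro (trans (IsGraph.sym g j i) eG) j<i))

size : ∀ {n} → Graph n → ℕ
size G = nV G + nE G

proper-size-< : ∀ {n} {H G : Graph n} → IsGraph G → ProperSubgraph H G → size H < size G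
proper-size-< {H = H} {G} g (H⊆G , inj₁ (v , Gv , Hv)) =
  +-mono-<-≤ (count-mono-< (Subgraph.V⊆ H⊆G) v Hv Gv) (nE-mono {H = H} {G} (Subgraph.E⊆ H⊆G))
proper-size-< {H = H} {G} g (H⊆G , inj₂ (i , j , Gij , Hij)) =
  +-mono-≤-< (count-mono (Subgraph.V⊆ H⊆G)) (nE-mono-< {H = H} {G} (Subgraph.E⊆ H⊆G) (Subgraph.wf H⊆G) g i j Gij Hij)

induced-⊆ : ∀ {n} {G : Graph n} (S : Fin n → Bool) → IsGraph G → Subgraph (induced G S) G
induced-⊆ {G = G} S g = record
  { wf = induced-isGraph S g ; V⊆ = λ _ h → ∧-elimˡ h ; E⊆ = λ i j h → ∧-elimˡ {E G i j} h }

induced-⊂ : ∀ {n} {G : Graph n} (S : Fin n → Bool) → IsGraph G → ∀ v → V G v ≡ true → S v ≡ false →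
            ProperSubgraph (induced G S) G
induced-⊂ {G = G} S g v Gv Sv = induced-⊆ S g , inj₁ (v , Gv , trans (cong (V G v ∧_) Sv) (∧-zeroʳ (V G v)))

module _ {n} {G : Graph n} (g : IsGraph G) {S : Fin n → Bool} (V⊆S : ∀ v → V G v ≡ true → S v ≡ true) where

  nV-spanning : nV (induced G S) ≡ nV G
  nV-spanning = count-cong keep
    where
    keep : ∀ v → V G v ∧ S v ≡ V G v
    keep v with V G v in Gv
    ... | true  = V⊆S v Gv
    ... | false = refl

  nE-spanning : nE (induced G S) ≡ nE G
  nE-spanning = sumF-cong (λ i → count-cong (λ j → cong (_∧ (toℕ i <ᵇ toℕ j)) (keep i j)))
    where
    keep : ∀ i j → E G i j ∧ S i ∧ S j ≡ E G i j
    keep i j with E G i j in e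
    ... | true  rewrite V⊆S i (IsGraph.inV g i j e) | V⊆S j (edge-inVʳ g e) = refl
    ... | false = refl

covers-or-misses : ∀ {n} (G : Graph n) (S : Fin n → Bool) →
                   (∀ v → V G v ≡ true → S v ≡ true) ⊎ Σ (Fin n) λ v → V G v ≡ true × S v ≡ false
covers-or-misses G S with anyF (λ v → V G v ∧ not (S v)) in missing
... | true  = let (v , v∉S) = anyF-witness (λ v → V G v ∧ not (S v)) missing in
              inj₂ (v , ∧-elimˡ v∉S , not≡true⇒≡false (∧-elimʳ {V G v} v∉S))
... | false = inj₁ covers
  where
  covers : ∀ v → V G v ≡ true → S v ≡ true
  covers v Gv with S v | anyF-false _ missing v
  ... | true  | _         = refl
  ... | false | missing-v = case trans (sym (cong (_∧ true) Gv)) missing-v of λ ()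

-- Packings of triangles and K₄s

module _ {A : Set} where

  Unique-++⁻ˡ : ∀ xs {ys : List A} → Unique (xs ++ ys) → Unique xs
  Unique-++⁻ˡ []       _        = []
  Unique-++⁻ˡ (x ∷ xs) (x∉ ∷ u) = All.++⁻ˡ xs x∉ ∷ Unique-++⁻ˡ xs u

  Unique-++⁻ʳ : ∀ xs {ys : List A} → Unique (xs ++ ys) → Unique ys
  Unique-++⁻ʳ []       u       = u
  Unique-++⁻ʳ (x ∷ xs) (_ ∷ u) = Unique-++⁻ʳ xs u

  Unique-++⁻-disjoint : ∀ xs {ys : List A} → Unique (xs ++ ys) → ∀ {x y} → x ∈ xs → y ∈ ys → x ≢ y
  Unique-++⁻-disjoint (x ∷ xs) (x∉ ∷ u) (here refl) y∈ = All.lookup (All.++⁻ʳ xs x∉) y∈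
  Unique-++⁻-disjoint (x ∷ xs) (_ ∷ u)  (there x∈)  y∈ = Unique-++⁻-disjoint xs u x∈ y∈

  countL : (A → Bool) → List A → ℕ
  countL p []       = 0
  countL p (x ∷ xs) = χ (p x) + countL p xs

  countL-++ : ∀ (p : A → Bool) xs ys → countL p (xs ++ ys) ≡ countL p xs + countL p ys
  countL-++ p []       ys = refl
  countL-++ p (x ∷ xs) ys = trans (cong (χ (p x) +_) (countL-++ p xs ys)) (sym (+-assoc (χ (p x)) _ _))

  countL-const-true : ∀ xs → countL (λ _ → true) xs ≡ length xs
  countL-const-true []       = refl
  countL-const-true (x ∷ xs) = cong suc (countL-const-true xs)

countL≤count : ∀ {n} (S p : Fin n → Bool) xs → Unique xs →
               All (λ x → p x ≡ true → S x ≡ true) xs → countL p xs ≤ count S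
countL≤count S p []       _          _          = z≤n
countL≤count S p (x ∷ xs) (x∉ ∷ u) (px⇒Sx ∷ h) with p x in px
... | false = countL≤count S p xs u h
... | true  = subst (suc (countL p xs) ≤_) (sym (count-remove S x (px⇒Sx refl)))
                (s≤s (countL≤count (λ y → S y ∧ not (y == x)) p xs u h′))
  where
  h′ : All (λ y → p y ≡ true → S y ∧ not (y == x) ≡ true) xs
  h′ = All.tabulate λ {y} y∈ py → ∧-intro (All.lookup h y∈ py)
         (cong not (==-≢ (λ y≡x → All.lookup x∉ y∈ (sym y≡x))))

partsValue : ∀ {n} → List (List (Fin n)) → ℕ
partsValue L = sum (map (λ Q → length Q ∸ 2) L)

partsValue-++ : ∀ {n} (A B : List (List (Fin n))) → partsValue (A ++ B) ≡ partsValue A + partsValue B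
partsValue-++ A B = trans (cong sum (List.map-++ (λ Q → length Q ∸ 2) A B))
  (sum-++ (map (λ Q → length Q ∸ 2) A) (map (λ Q → length Q ∸ 2) B))

partsValue≤length : ∀ {n} (L : List (List (Fin n))) → partsValue L ≤ length (concat L)
partsValue≤length []      = z≤n
partsValue≤length (P ∷ L) = subst (length P ∸ 2 + partsValue L ≤_) (sym (List.length-++ P))
  (+-mono-≤ (m∸n≤m (length P) 2) (partsValue≤length L))

clique-value≤2 : ∀ {n} {H : Graph n} {P} → IsClique34 H P → length P ∸ 2 ≤ 2
clique-value≤2 (inj₁ three , _) rewrite three = s≤s z≤n
clique-value≤2 (inj₂ four  , _) rewrite four  = ≤-refl

packValue≤n : ∀ {n} {H : Graph n} (P : Packing H) → packValue P ≤ n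
packValue≤n {n} P = ≤-trans (partsValue≤length (Packing.parts P))
  (subst (_≤ n) (countL-const-true (concat (Packing.parts P)))
    (≤-trans (countL≤count (λ _ → true) (λ _ → true) _ (Packing.disjoint P) (All.tabulate (λ _ _ → refl)))
             (count≤n {n} (λ _ → true))))

emptyPacking : ∀ {n} (H : Graph n) → Packing H
emptyPacking H = record { parts = [] ; disjoint = [] ; cliques = [] }

module _ {n} {H H′ : Graph n} (V⊆ : ∀ i → V H i ≡ true → V H′ i ≡ true)
                              (E⊆ : ∀ i j → E H i j ≡ true → E H′ i j ≡ true) where

  clique-mono : ∀ P → IsClique34 H P → IsClique34 H′ P
  clique-mono P (size , inV , adj) = size , All.map (V⊆ _) inV , λ u v u∈ v∈ u≢v → E⊆ u v (adj u v u∈ v∈ u≢v)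

  packing-mono : Packing H → Packing H′
  packing-mono P = record
    { parts = Packing.parts P ; disjoint = Packing.disjoint P
    ; cliques = All.map (clique-mono _) (Packing.cliques P) }

  T-mono : ∀ {t t′} → IsT H t → IsT H′ t′ → t ≤ t′
  T-mono ((P , refl) , _) (_ , max′) = max′ (packing-mono P)

-- Maxima and critical subgraphs, in the double-negation monad

¬¬-maximum : ∀ {A : Set} (f : A → ℕ) (B : ℕ) → (∀ a → f a ≤ B) → A → ¬ ¬ (Σ A λ a → ∀ b → f b ≤ f a)
¬¬-maximum {A} f B f≤B a₀ = climb (suc B) a₀ (m≤n+m (suc B) (f a₀))
  where
  -- gap bounds how many strict improvements are still possible.
  climb : ∀ gap a → suc B ≤ f a + gap → ¬ ¬ (Σ A λ a → ∀ b → f b ≤ f a)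
  climb zero a h = λ _ → <-irrefl refl (≤-trans (subst (suc B ≤_) (+-identityʳ (f a)) h) (f≤B a))
  climb (suc gap) a h = do
    yes (b , fa<fb) ← ¬¬-excluded-middle {A = Σ A λ b → f a < f b}
      where no none → pure (a , λ b → decidable-stable (f b ≤? f a) (λ fb≰fa → none (b , ≰⇒> fb≰fa)))
    climb gap b (≤-trans h (subst (_≤ f b + gap) (sym (+-suc (f a) gap)) (+-monoˡ-≤ gap fa<fb)))

¬¬-T : ∀ {m} (H : Graph m) → ¬ ¬ (Σ ℕ (IsT H))
¬¬-T {m} H = do
  (P , max) ← ¬¬-maximum packValue m packValue≤n (emptyPacking H)
  pure (packValue P , (P , refl) , max)

∃-function? : ∀ m {k} (P : (Fin m → Fin k) → Set) → (∀ c → Dec (P c)) →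
              (∀ {c c′} → (∀ i → c i ≡ c′ i) → P c → P c′) → Dec (Σ _ P)
∃-function? zero P P? resp with P? (λ ())
... | yes p = yes (_ , p)
... | no ¬p = no (λ (c , p) → ¬p (resp (λ ()) p))
∃-function? (suc m) P P? resp
  with Fin.any? (λ x → ∃-function? m (λ c → P (x Vector.∷ c)) (λ c → P? (x Vector.∷ c))
                                     (λ h → resp λ { zero → refl ; (suc i) → h i }))
... | yes (x , c , p) = yes (_ , p)
... | no ¬p           = no (λ (c , p) → ¬p (c zero , Vector.tail c , resp (λ { zero → refl ; (suc i) → refl }) p))

colorable? : ∀ {m} (H : Graph m) k → Dec (Colorable H k)
colorable? {m} H k = ∃-function? m (Coloring H k)
  (λ c → Fin.all? (λ i → Fin.all? (λ j → (E H i j Bool.≟ true) →-dec ¬? (c i Fin.≟ c j))))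
  (λ c≗c′ proper i j e eq → proper i j e (trans (c≗c′ i) (trans eq (sym (c≗c′ j)))))

¬¬-critical-subgraph : ∀ {m} {H : Graph m} → IsGraph H → ¬ Colorable H 4 →
                       ¬ ¬ (Σ (Graph m) λ W → Subgraph W H × Critical5 W)
¬¬-critical-subgraph {m} {H} h ¬col = descend (suc (size H)) ≤-refl h ¬col
  where
  descend : ∀ s {H : Graph m} → size H < s → IsGraph H → ¬ Colorable H 4 →
            ¬ ¬ (Σ (Graph m) λ W → Subgraph W H × Critical5 W)
  descend (suc s) {H} (s≤s size≤s) h ¬col = do
    no none ← ¬¬-excluded-middle {A = Σ (Graph m) λ H′ → ProperSubgraph H′ H × ¬ Colorable H′ 4}
      where yes (H′ , H′⊂H , ¬col′) → do
              (W , W⊆H′ , W-critical) ← descend s (≤-trans (proper-size-< h H′⊂H) size≤s)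
                                                 (Subgraph.wf (proj₁ H′⊂H)) ¬col′
              pure (W , ⊆-trans W⊆H′ (proj₁ H′⊂H) , W-critical)
    pure (H , ⊆-refl h , record
      { not4col = ¬col
      ; sub4col = λ H′ H′⊂H → decidable-stable (colorable? H′ 4) (λ ¬col′ → none (H′ , H′⊂H , ¬col′)) })

-- The graph G_φ(R)

data SplitView {m k} : Fin (m + k) → Set where
  inˡ : (a : Fin m) → SplitView (a ↑ˡ k)
  inʳ : (i : Fin k) → SplitView (m ↑ʳ i)

splitView : ∀ {m k} (p : Fin (m + k)) → SplitView {m} {k} p
splitView {m} p with splitAt m p in eq
... | inj₁ a = subst SplitView (splitAt⁻¹-↑ˡ eq) (inˡ a)
... | inj₂ i = subst SplitView (splitAt⁻¹-↑ʳ eq) (inʳ i)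

module _ {n} (G : Graph n) (R : Fin n → Bool) (φ : Fin n → Fin 4) where

  adjacentToClass : Fin n → Fin 4 → Bool
  adjacentToClass a i = not (R a) ∧ anyF (λ r → R r ∧ (φ r == i) ∧ E G a r)

  Gφ-Vˡ : ∀ a → V (Gφ G R φ) (a ↑ˡ 4) ≡ V G a ∧ not (R a)
  Gφ-Vˡ a rewrite splitAt-↑ˡ n a 4 = refl

  Gφ-Vʳ : ∀ i → V (Gφ G R φ) (n ↑ʳ i) ≡ true
  Gφ-Vʳ i rewrite splitAt-↑ʳ n 4 i = refl

  Gφ-Eˡˡ : ∀ a b → E (Gφ G R φ) (a ↑ˡ 4) (b ↑ˡ 4) ≡ E G a b ∧ not (R a) ∧ not (R b)
  Gφ-Eˡˡ a b rewrite splitAt-↑ˡ n a 4 | splitAt-↑ˡ n b 4 = refl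

  Gφ-Eˡʳ : ∀ a i → E (Gφ G R φ) (a ↑ˡ 4) (n ↑ʳ i) ≡ adjacentToClass a i
  Gφ-Eˡʳ a i rewrite splitAt-↑ˡ n a 4 | splitAt-↑ʳ n 4 i = refl

  Gφ-Eʳˡ : ∀ i a → E (Gφ G R φ) (n ↑ʳ i) (a ↑ˡ 4) ≡ adjacentToClass a i
  Gφ-Eʳˡ i a rewrite splitAt-↑ˡ n a 4 | splitAt-↑ʳ n 4 i = refl

  Gφ-Eʳʳ : ∀ i j → E (Gφ G R φ) (n ↑ʳ i) (n ↑ʳ j) ≡ not (i == j)
  Gφ-Eʳʳ i j rewrite splitAt-↑ʳ n 4 i | splitAt-↑ʳ n 4 j = refl

  module _ {W : Graph (n + 4)} (W⊆Gφ : Subgraph W (Gφ G R φ)) where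

    extender-V : ∀ a → V W (a ↑ˡ 4) ≡ true → V G a ∧ not (R a) ≡ true
    extender-V a h = trans (sym (Gφ-Vˡ a)) (Subgraph.V⊆ W⊆Gφ (a ↑ˡ 4) h)

    extender-E : ∀ a b → E W (a ↑ˡ 4) (b ↑ˡ 4) ≡ true → E G a b ≡ true
    extender-E a b h = ∧-elimˡ (trans (sym (Gφ-Eˡˡ a b)) (Subgraph.E⊆ W⊆Gφ _ _ h))

module _ {n} {G : Graph n} (g : IsGraph G) (R : Fin n → Bool) (φ : Fin n → Fin 4) where

  adjacentToClass-V : ∀ a i → adjacentToClass G R φ a i ≡ true → V G a ∧ not (R a) ≡ true
  adjacentToClass-V a i h with anyF-witness (λ r → R r ∧ (φ r == i) ∧ E G a r) (∧-elimʳ {not (R a)} h)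
  ... | r , hr = ∧-intro (IsGraph.inV g a r (∧-elimʳ {φ r == i} (∧-elimʳ {R r} hr))) (∧-elimˡ h)

  Gφ-isGraph : IsGraph (Gφ G R φ)
  Gφ-isGraph = record { sym = symmetric ; irr = irreflexive ; inV = incident }
    where
    symmetric : ∀ p q → E (Gφ G R φ) p q ≡ E (Gφ G R φ) q p
    symmetric p q with splitView {n} {4} p | splitView {n} {4} q
    ... | inˡ a | inˡ b rewrite Gφ-Eˡˡ G R φ a b | Gφ-Eˡˡ G R φ b a | IsGraph.sym g a b
          with R a | R b
    ... | true  | true  = refl
    ... | true  | false = refl
    ... | false | true  = refl
    ... | false | false = refl
    symmetric p q | inˡ a | inʳ i = trans (Gφ-Eˡʳ G R φ a i) (sym (Gφ-Eʳˡ G R φ i a))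
    symmetric p q | inʳ i | inˡ a = trans (Gφ-Eʳˡ G R φ i a) (sym (Gφ-Eˡʳ G R φ a i))
    symmetric p q | inʳ i | inʳ j =
      trans (Gφ-Eʳʳ G R φ i j) (trans (cong not (==-sym i j)) (sym (Gφ-Eʳʳ G R φ j i)))
    irreflexive : ∀ p → E (Gφ G R φ) p p ≡ false
    irreflexive p with splitView {n} {4} p
    ... | inˡ a rewrite Gφ-Eˡˡ G R φ a a | IsGraph.irr g a = refl
    ... | inʳ i rewrite Gφ-Eʳʳ G R φ i i | ==-refl i = refl
    incident : ∀ p q → E (Gφ G R φ) p q ≡ true → V (Gφ G R φ) p ≡ true
    incident p q h with splitView {n} {4} p | splitView {n} {4} q
    ... | inˡ a | inˡ b rewrite Gφ-Vˡ G R φ a | Gφ-Eˡˡ G R φ a b =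
          ∧-intro (IsGraph.inV g a b (∧-elimˡ h)) (∧-elimˡ (∧-elimʳ {E G a b} h))
    ... | inˡ a | inʳ i rewrite Gφ-Vˡ G R φ a | Gφ-Eˡʳ G R φ a i = adjacentToClass-V a i h
    ... | inʳ i | _ = Gφ-Vʳ G R φ i

  -- A colouring of G_φ(R) pulls back to G: vertices of R take the colour of their class.
  Gφ-not4colorable : Coloring (induced G R) 4 φ → ¬ Colorable G 4 → ¬ Colorable (Gφ G R φ) 4
  Gφ-not4colorable φ-proper G-not4colorable (c , c-proper) = G-not4colorable (c′ , c′-proper)
    where
    c′ : Fin n → Fin 4
    c′ a = if R a then c (n ↑ʳ φ a) else c (a ↑ˡ 4)
    class-edge : ∀ a r → R a ≡ false → R r ≡ true → E G a r ≡ true →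
                 E (Gφ G R φ) (a ↑ˡ 4) (n ↑ʳ φ r) ≡ true
    class-edge a r ra rr e = trans (Gφ-Eˡʳ G R φ a (φ r))
      (∧-intro (cong not ra) (anyF-intro _ r (∧-intro rr (∧-intro (==-refl (φ r)) e))))
    c′-proper : Coloring G 4 c′
    c′-proper a b e with R a in ra | R b in rb
    ... | true  | true  = c-proper (n ↑ʳ φ a) (n ↑ʳ φ b) (trans (Gφ-Eʳʳ G R φ (φ a) (φ b))
            (cong not (==-≢ (φ-proper a b (∧-intro e (∧-intro ra rb))))))
    ... | true  | false = λ eq → c-proper (b ↑ˡ 4) (n ↑ʳ φ a)
            (class-edge b a rb ra (trans (IsGraph.sym g b a) e)) (sym eq)
    ... | false | true  = c-proper (a ↑ˡ 4) (n ↑ʳ φ b) (class-edge a b ra rb e)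
    ... | false | false = c-proper (a ↑ˡ 4) (b ↑ˡ 4)
            (trans (Gφ-Eˡˡ G R φ a b) (∧-intro e (∧-intro (cong not ra) (cong not rb))))

module _ {n} {G : Graph n} {R : Fin n → Bool} {φ : Fin n → Fin 4}
         {W : Graph (n + 4)} (W⊆Gφ : Subgraph W (Gφ G R φ)) (W-critical : Critical5 W) where

  private
    w = Subgraph.wf W⊆Gφ

  -- Otherwise W lives on the clique x₁…x₄ and is coloured by the class index.
  extender-meets-original : Σ (Fin n) λ a → V W (a ↑ˡ 4) ≡ true
  extender-meets-original with anyF (λ a → V W (a ↑ˡ 4)) in any-a
  ... | true  = anyF-witness _ any-a
  ... | false = ⊥-elim (Critical5.not4col W-critical (c , c-proper))
    where
    c : Fin (n + 4) → Fin 4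
    c p = [ (λ _ → zero) , (λ i → i) ]′ (splitAt n p)
    absent : ∀ a → V W (a ↑ˡ 4) ≡ true → ⊥
    absent a h with trans (sym h) (anyF-false (λ a → V W (a ↑ˡ 4)) any-a a)
    ... | ()
    c-proper : Coloring W 4 c
    c-proper p q e with splitView {n} {4} p | splitView {n} {4} q
    ... | inˡ a | _     = ⊥-elim (absent a (IsGraph.inV w _ _ e))
    ... | inʳ i | inˡ b = ⊥-elim (absent b (edge-inVʳ w e))
    ... | inʳ i | inʳ j rewrite splitAt-↑ʳ n 4 i | splitAt-↑ʳ n 4 j =
      not-==⇒≢ (trans (sym (Gφ-Eʳʳ G R φ i j)) (Subgraph.E⊆ W⊆Gφ _ _ e))

  -- Otherwise W is (a copy of) a proper subgraph of G, hence 4-colourable.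
  extender-meets-identified : (∀ H → ProperSubgraph H G → Colorable H 4) →
                              (Σ (Fin n) λ r → V G r ≡ true × V W (r ↑ˡ 4) ≡ false) →
                              anyF (λ i → V W (n ↑ʳ i)) ≡ true
  extender-meets-identified G-sub4col (r , Gr , Wr) with anyF (λ i → V W (n ↑ʳ i)) in any-x
  ... | true  = refl
  ... | false = ⊥-elim (Critical5.not4col W-critical (c , c-proper))
    where
    Wˡ : Graph n
    Wˡ = mkGraph (λ a → V W (a ↑ˡ 4)) (λ a b → E W (a ↑ˡ 4) (b ↑ˡ 4))
    Wˡ⊂G : ProperSubgraph Wˡ G
    Wˡ⊂G = record
      { wf  = record { sym = λ _ _ → IsGraph.sym w _ _ ; irr = λ _ → IsGraph.irr w _
                     ; inV = λ _ _ h → IsGraph.inV w _ _ h }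
      ; V⊆ = λ a h → ∧-elimˡ (extender-V G R φ W⊆Gφ a h)
      ; E⊆ = extender-E G R φ W⊆Gφ }
      , inj₁ (r , Gr , Wr)
    cˡ = G-sub4col Wˡ Wˡ⊂G
    c : Fin (n + 4) → Fin 4
    c p = [ proj₁ cˡ , (λ _ → zero) ]′ (splitAt n p)
    absent : ∀ i → V W (n ↑ʳ i) ≡ true → ⊥
    absent i h with trans (sym h) (anyF-false (λ i → V W (n ↑ʳ i)) any-x i)
    ... | ()
    c-proper : Coloring W 4 c
    c-proper p q e with splitView {n} {4} p | splitView {n} {4} q
    ... | inˡ a | inˡ b rewrite splitAt-↑ˡ n a 4 | splitAt-↑ˡ n b 4 = proj₂ cˡ a b e
    ... | inˡ a | inʳ i = ⊥-elim (absent i (edge-inVʳ w e))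
    ... | inʳ i | _     = ⊥-elim (absent i (IsGraph.inV w _ _ e))

-- Extenders

module Split (n k : ℕ) where

  isOriginal : Fin (n + k) → Bool
  isOriginal p = [ (λ _ → true) , (λ _ → false) ]′ (splitAt n p)

  isOriginal-↑ˡ : ∀ a → isOriginal (a ↑ˡ k) ≡ true
  isOriginal-↑ˡ a rewrite splitAt-↑ˡ n a k = refl

  isOriginal-↑ʳ : ∀ i → isOriginal (n ↑ʳ i) ≡ false
  isOriginal-↑ʳ i rewrite splitAt-↑ʳ n k i = refl

  originals : List (Fin (n + k)) → List (Fin n)
  originals []       = []
  originals (p ∷ ps) = [ (_∷ originals ps) , (λ _ → originals ps) ]′ (splitAt n p)

  originals-↑ˡ : ∀ a ps → originals ((a ↑ˡ k) ∷ ps) ≡ a ∷ originals ps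
  originals-↑ˡ a ps rewrite splitAt-↑ˡ n a k = refl

  originals-↑ʳ : ∀ i ps → originals ((n ↑ʳ i) ∷ ps) ≡ originals ps
  originals-↑ʳ i ps rewrite splitAt-↑ʳ n k i = refl

  allOriginal : List (Fin (n + k)) → Bool
  allOriginal []       = true
  allOriginal (p ∷ ps) = isOriginal p ∧ allOriginal ps

  identifiedCount : List (Fin (n + k)) → ℕ
  identifiedCount = countL (λ p → not (isOriginal p))

  originals-all : ∀ P → allOriginal P ≡ true → map (_↑ˡ k) (originals P) ≡ P
  originals-all []       _ = refl
  originals-all (p ∷ ps) h with splitView {n} {k} p
  ... | inˡ a rewrite originals-↑ˡ a ps | isOriginal-↑ˡ a = cong ((a ↑ˡ k) ∷_) (originals-all ps h)
  ... | inʳ i rewrite isOriginal-↑ʳ i with h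
  ... | ()

  length-originals-all : ∀ P → allOriginal P ≡ true → length (originals P) ≡ length P
  length-originals-all P h = trans (sym (List.length-map (_↑ˡ k) (originals P))) (cong length (originals-all P h))

  identifiedCount-not-all : ∀ P → allOriginal P ≡ false → 1 ≤ identifiedCount P
  identifiedCount-not-all (p ∷ ps) h with isOriginal p
  ... | false = s≤s z≤n
  ... | true  = ≤-trans (identifiedCount-not-all ps h) (m≤n+m (identifiedCount ps) 0)

  ∈-originals : ∀ {a} P → a ∈ originals P → (a ↑ˡ k) ∈ P
  ∈-originals (p ∷ ps) a∈ with splitView {n} {k} p
  ... | inˡ b rewrite originals-↑ˡ b ps with a∈
  ... | here refl = here refl
  ... | there a∈′ = there (∈-originals ps a∈′)
  ∈-originals (p ∷ ps) a∈ | inʳ i rewrite originals-↑ʳ i ps = there (∈-originals ps a∈)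

  originals-Unique : ∀ P → Unique P → Unique (originals P)
  originals-Unique []       _        = []
  originals-Unique (p ∷ ps) (p∉ ∷ u) with splitView {n} {k} p
  ... | inˡ b rewrite originals-↑ˡ b ps =
        All.tabulate (λ a∈ b≡a → All.lookup p∉ (∈-originals ps a∈) (cong (_↑ˡ k) b≡a)) ∷ originals-Unique ps u
  ... | inʳ i rewrite originals-↑ʳ i ps = originals-Unique ps u

  restrict : List (List (Fin (n + k))) → List (List (Fin n))
  restrict []      = []
  restrict (P ∷ L) with allOriginal P
  ... | true  = originals P ∷ restrict L
  ... | false = restrict L

  ∈-restrict : ∀ {a} L → a ∈ concat (restrict L) → (a ↑ˡ k) ∈ concat L
  ∈-restrict (P ∷ L) a∈ with allOriginal P
  ... | false = ∈.∈-++⁺ʳ P (∈-restrict L a∈)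
  ... | true with ∈.∈-++⁻ (originals P) a∈
  ... | inj₁ a∈P = ∈.∈-++⁺ˡ (∈-originals P a∈P)
  ... | inj₂ a∈L = ∈.∈-++⁺ʳ P (∈-restrict L a∈L)

  restrict-Unique : ∀ L → Unique (concat L) → Unique (concat (restrict L))
  restrict-Unique []      _ = []
  restrict-Unique (P ∷ L) u with allOriginal P
  ... | false = restrict-Unique L (Unique-++⁻ʳ P u)
  ... | true  = Unique.++⁺ (originals-Unique P (Unique-++⁻ˡ P u)) (restrict-Unique L (Unique-++⁻ʳ P u))
                  λ (a∈ , a∈′) → Unique-++⁻-disjoint P u (∈-originals P a∈) (∈-restrict L a∈′) refl

  -- Each discarded part is worth at most 2 and contains an identified vertex.
  partsValue-restrict : ∀ L → All (λ P → length P ∸ 2 ≤ 2) L →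
                        partsValue L ≤ partsValue (restrict L) + 2 * identifiedCount (concat L)
  partsValue-restrict []      _        = z≤n
  partsValue-restrict (P ∷ L) (P≤2 ∷ L≤2)
    rewrite countL-++ (λ p → not (isOriginal p)) P (concat L) with allOriginal P in allP
  ... | true rewrite length-originals-all P allP = begin
      length P ∸ 2 + partsValue L
        ≤⟨ +-monoʳ-≤ (length P ∸ 2) (partsValue-restrict L L≤2) ⟩
      length P ∸ 2 + (partsValue (restrict L) + 2 * c)
        ≡⟨ sym (+-assoc (length P ∸ 2) _ _) ⟩
      length P ∸ 2 + partsValue (restrict L) + 2 * c
        ≤⟨ +-monoʳ-≤ (length P ∸ 2 + partsValue (restrict L)) (*-monoʳ-≤ 2 (m≤n+m c (identifiedCount P))) ⟩
      length P ∸ 2 + partsValue (restrict L) + 2 * (identifiedCount P + c) ∎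
    where
    open ≤-Reasoning
    c = identifiedCount (concat L)
  ... | false = begin
      length P ∸ 2 + partsValue L
        ≤⟨ +-mono-≤ (≤-trans P≤2 (*-monoʳ-≤ 2 (identifiedCount-not-all P allP))) (partsValue-restrict L L≤2) ⟩
      2 * identifiedCount P + (partsValue (restrict L) + 2 * c)
        ≡⟨ +-comm (2 * identifiedCount P) _ ⟩
      partsValue (restrict L) + 2 * c + 2 * identifiedCount P
        ≡⟨ +-assoc (partsValue (restrict L)) (2 * c) _ ⟩
      partsValue (restrict L) + (2 * c + 2 * identifiedCount P)
        ≡⟨ cong (partsValue (restrict L) +_) (trans (sym (*-distribˡ-+ 2 c (identifiedCount P))) (cong (2 *_) (+-comm c (identifiedCount P)))) ⟩
      partsValue (restrict L) + 2 * (identifiedCount P + c) ∎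
    where
    open ≤-Reasoning
    c = identifiedCount (concat L)

module Extender {n} {G : Graph n} (g : IsGraph G) (R : Fin n → Bool) (φ : Fin n → Fin 4)
                {W : Graph (n + 4)} (W⊆Gφ : Subgraph W (Gφ G R φ)) where

  open Split n 4
  private
    w = Subgraph.wf W⊆Gφ

  Wᵒ : Fin n → Bool
  Wᵒ a = V W (a ↑ˡ 4)

  Wˣ : Fin 4 → Bool
  Wˣ i = V W (n ↑ʳ i)

  R∧Wᵒ≡false : ∀ a → R a ∧ Wᵒ a ≡ false
  R∧Wᵒ≡false a with R a in ra | Wᵒ a in wa
  ... | false | _     = refl
  ... | true  | false = refl
  ... | true  | true with trans (cong not (sym ra)) (∧-elimʳ {V G a} (extender-V G R φ W⊆Gφ a wa))
  ... | ()

  private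
    arcsRR arcsOO arcsOR arcsRO : Fin n → Fin n → ℕ
    arcsRR a b = χ (E G a b ∧ R a ∧ R b)
    arcsOO a b = χ (E G a b ∧ Wᵒ a ∧ Wᵒ b)
    arcsOR a b = χ (E G a b ∧ Wᵒ a ∧ R b)
    arcsRO a b = χ (E G a b ∧ R a ∧ Wᵒ b)

    classArcs : Fin n → Fin 4 → ℕ
    classArcs a i = χ (Wᵒ a ∧ adjacentToClass G R φ a i)

  arcs-R∨Wᵒ : arcs (induced G (λ a → R a ∨ Wᵒ a)) ≡
              sumF₂ arcsRR + sumF₂ arcsOO + sumF₂ arcsOR + sumF₂ arcsRO
  arcs-R∨Wᵒ = begin
    arcs (induced G (λ a → R a ∨ Wᵒ a))
      ≡⟨ sumF₂-cong (λ a b → χ-∧-∨∨ (E G a b) (R a) (Wᵒ a) (R b) (Wᵒ b) (R∧Wᵒ≡false a) (R∧Wᵒ≡false b)) ⟩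
    sumF₂ (λ a b → arcsRR a b + arcsOO a b + arcsOR a b + arcsRO a b)
      ≡⟨ sumF₂-distrib-+ (λ a b → arcsRR a b + arcsOO a b + arcsOR a b) arcsRO ⟩
    sumF₂ (λ a b → arcsRR a b + arcsOO a b + arcsOR a b) + sumF₂ arcsRO
      ≡⟨ cong (_+ sumF₂ arcsRO) (sumF₂-distrib-+ (λ a b → arcsRR a b + arcsOO a b) arcsOR) ⟩
    sumF₂ (λ a b → arcsRR a b + arcsOO a b) + sumF₂ arcsOR + sumF₂ arcsRO
      ≡⟨ cong (λ x → x + sumF₂ arcsOR + sumF₂ arcsRO) (sumF₂-distrib-+ arcsRR arcsOO) ⟩
    sumF₂ arcsRR + sumF₂ arcsOO + sumF₂ arcsOR + sumF₂ arcsRO ∎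
    where open ≡-Reasoning

  arcsRO≡arcsOR : sumF₂ arcsRO ≡ sumF₂ arcsOR
  arcsRO≡arcsOR = trans (sumF₂-transpose arcsRO)
    (sumF₂-cong (λ a b → cong χ (cong₂ _∧_ (IsGraph.sym g b a) (∧-comm (R b) (Wᵒ a)))))

  R∨Wᵒ⊆V : (∀ a → R a ≡ true → V G a ≡ true) → ∀ a → R a ∨ Wᵒ a ≡ true → V G a ≡ true
  R∨Wᵒ⊆V R⊆V a h with R a in ra | Wᵒ a in wa
  ... | true  | _    = R⊆V a ra
  ... | false | true = ∧-elimˡ (extender-V G R φ W⊆Gφ a wa)

  R<R∨Wᵒ : Critical5 W → count R < count (λ a → R a ∨ Wᵒ a)
  R<R∨Wᵒ W-critical with extender-meets-original W⊆Gφ W-critical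
  ... | a , Wa = count-mono-< (λ b Rb → subst (λ x → x ∨ Wᵒ b ≡ true) (sym Rb) refl) a
                   (not≡true⇒≡false (∧-elimʳ {V G a} (extender-V G R φ W⊆Gφ a Wa)))
                   (subst (λ x → R a ∨ x ≡ true) (sym Wa) (∨-zeroʳ (R a)))

  nV-W : nV W ≡ count Wᵒ + count Wˣ
  nV-W = count-↑ 4 (V W)

  arcs-W≤ : arcs W ≤ (sumF₂ arcsOO + sumF₂ classArcs) + (sumF₂ classArcs + orderedPairs Wˣ)
  arcs-W≤ = begin
    arcs W
      ≡⟨ sumF₂-↑ 4 (λ p q → χ (E W p q)) ⟩
    (sumF₂ (λ a b → χ (E W (a ↑ˡ 4) (b ↑ˡ 4))) + sumF₂ (λ a j → χ (E W (a ↑ˡ 4) (n ↑ʳ j))))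
      + (sumF₂ (λ i b → χ (E W (n ↑ʳ i) (b ↑ˡ 4))) + sumF₂ (λ i j → χ (E W (n ↑ʳ i) (n ↑ʳ j))))
      ≤⟨ +-mono-≤ (+-mono-≤ (sumF₂-mono original-original) (sumF₂-mono original-class))
                  (+-mono-≤ (sumF₂-mono class-original) (sumF₂-mono class-class)) ⟩
    (sumF₂ arcsOO + sumF₂ classArcs) + (sumF₂ (λ i a → classArcs a i) + orderedPairs Wˣ)
      ≡⟨ cong (λ x → (sumF₂ arcsOO + sumF₂ classArcs) + (x + orderedPairs Wˣ))
              (sym (sumF₂-transpose classArcs)) ⟩
    (sumF₂ arcsOO + sumF₂ classArcs) + (sumF₂ classArcs + orderedPairs Wˣ) ∎
    where
    open ≤-Reasoning
    E⊆ = Subgraph.E⊆ W⊆Gφ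
    original-original : ∀ a b → χ (E W (a ↑ˡ 4) (b ↑ˡ 4)) ≤ arcsOO a b
    original-original a b = χ-mono λ e →
      ∧-intro (extender-E G R φ W⊆Gφ a b e) (∧-intro (IsGraph.inV w _ _ e) (edge-inVʳ w e))
    original-class : ∀ a i → χ (E W (a ↑ˡ 4) (n ↑ʳ i)) ≤ classArcs a i
    original-class a i = χ-mono λ e →
      ∧-intro (IsGraph.inV w _ _ e) (trans (sym (Gφ-Eˡʳ G R φ a i)) (E⊆ _ _ e))
    class-original : ∀ i a → χ (E W (n ↑ʳ i) (a ↑ˡ 4)) ≤ classArcs a i
    class-original i a = χ-mono λ e →
      ∧-intro (edge-inVʳ w e) (trans (sym (Gφ-Eʳˡ G R φ i a)) (E⊆ _ _ e))
    class-class : ∀ i j → χ (E W (n ↑ʳ i) (n ↑ʳ j)) ≤ χ (Wˣ i ∧ Wˣ j ∧ not (i == j))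
    class-class i j = χ-mono λ e →
      ∧-intro (IsGraph.inV w _ _ e) (∧-intro (edge-inVʳ w e) (trans (sym (Gφ-Eʳʳ G R φ i j)) (E⊆ _ _ e)))

  -- An original vertex adjacent to the classes i₁, i₂, … has distinct neighbours in R of those colours.
  classArcs≤arcsOR : sumF₂ classArcs ≤ sumF₂ arcsOR
  classArcs≤arcsOR = sumF-mono row
    where
    reorder : ∀ r c e → r ∧ c ∧ e ≡ (r ∧ e) ∧ c
    reorder false c e = refl
    reorder true  c e = ∧-comm c e
    row : ∀ a → sumF (classArcs a) ≤ sumF (arcsOR a)
    row a with Wᵒ a
    ... | false = z≤n
    ... | true  = begin
      sumF (λ i → χ (adjacentToClass G R φ a i))
        ≤⟨ sumF-mono (λ i → ≤-trans (χ-∧ˡ (not (R a)) _) (χ-anyF≤count (λ r → R r ∧ (φ r == i) ∧ E G a r))) ⟩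
      sumF (λ i → count (λ r → R r ∧ (φ r == i) ∧ E G a r))
        ≡⟨ sumF-cong (λ i → count≡sumF (λ r → R r ∧ (φ r == i) ∧ E G a r)) ⟩
      sumF₂ (λ i r → χ (R r ∧ (φ r == i) ∧ E G a r))
        ≡⟨ sumF₂-transpose (λ i r → χ (R r ∧ (φ r == i) ∧ E G a r)) ⟩
      sumF₂ (λ r i → χ (R r ∧ (φ r == i) ∧ E G a r))
        ≡⟨ sumF-cong (λ r → trans (sumF-cong (λ i → cong χ (reorder (R r) (φ r == i) (E G a r))))
                                  (sumF-χ-==ʳ (φ r) (R r ∧ E G a r))) ⟩
      sumF (λ r → χ (R r ∧ E G a r))
        ≡⟨ sumF-cong (λ r → cong χ (∧-comm (R r) (E G a r))) ⟩
      sumF (λ b → χ (E G a b ∧ true ∧ R b)) ∎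
      where open ≤-Reasoning

  arcs-extension : arcs (induced G R) + arcs W ≤ arcs (induced G (λ a → R a ∨ Wᵒ a)) + orderedPairs Wˣ
  arcs-extension = begin
    A + arcs W
      ≤⟨ +-monoʳ-≤ A arcs-W≤ ⟩
    A + ((B + Y) + (Y + X))
      ≤⟨ +-monoʳ-≤ A (+-mono-≤ (+-monoʳ-≤ B classArcs≤arcsOR) (+-monoˡ-≤ X classArcs≤arcsOR)) ⟩
    A + ((B + C) + (C + X))
      ≡⟨ regroup A B C X ⟩
    A + B + C + C + X
      ≡⟨ cong (λ c → A + B + C + c + X) (sym arcsRO≡arcsOR) ⟩
    A + B + C + sumF₂ arcsRO + X
      ≡⟨ cong (_+ X) (sym arcs-R∨Wᵒ) ⟩
    arcs (induced G (λ a → R a ∨ Wᵒ a)) + X ∎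
    where
    open ≤-Reasoning
    A = sumF₂ arcsRR
    B = sumF₂ arcsOO
    C = sumF₂ arcsOR
    Y = sumF₂ classArcs
    X = orderedPairs Wˣ
    regroup : ∀ a b c x → a + ((b + c) + (c + x)) ≡ a + b + c + c + x
    regroup a b c x = solve 4 (λ a b c x → a :+ ((b :+ c) :+ (c :+ x)) := a :+ b :+ c :+ c :+ x) refl a b c x
      where open ℕ-Solver.+-*-Solver

  module _ {R′ : Fin n → Bool} (R′≡ : ∀ a → R′ a ≡ R a ∨ Wᵒ a) where

    nV-R′ : nV (induced G R′) ≡ nV (induced G R) + count Wᵒ
    nV-R′ = trans (count-cong (λ a → trans (cong (V G a ∧_) (R′≡ a)) (distrib a)))
                  (count-∨ (λ a → V G a ∧ R a) Wᵒ (λ a → disjoint a))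
      where
      distrib : ∀ a → V G a ∧ (R a ∨ Wᵒ a) ≡ (V G a ∧ R a) ∨ Wᵒ a
      distrib a with V G a in va | Wᵒ a in wa
      ... | true  | _     = refl
      ... | false | false = refl
      ... | false | true  = trans (sym va) (∧-elimˡ (extender-V G R φ W⊆Gφ a wa))
      disjoint : ∀ a → (V G a ∧ R a) ∧ Wᵒ a ≡ false
      disjoint a with V G a
      ... | true  = R∧Wᵒ≡false a
      ... | false = refl

    nE-R′ : nE (induced G R) + nE (induced G R) + (nE W + nE W) ≤ nE (induced G R′) + nE (induced G R′) + orderedPairs Wˣ
    nE-R′ = subst₂ _≤_ (cong₂ _+_ (arcs≡nE+nE (induced-isGraph R g)) (arcs≡nE+nE w))
                       (cong (_+ orderedPairs Wˣ) (trans (sumF₂-cong (λ a b → cong χ (cong₂ (λ x y → E G a b ∧ x ∧ y) (sym (R′≡ a)) (sym (R′≡ b)))))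
                                                       (arcs≡nE+nE (induced-isGraph R′ g))))
                       arcs-extension

    R⊆R′ : ∀ a → R a ≡ true → R′ a ≡ true
    R⊆R′ a h rewrite R′≡ a | h = refl

    Wᵒ⊆R′ : ∀ a → Wᵒ a ≡ true → R′ a ≡ true
    Wᵒ⊆R′ a h rewrite R′≡ a | h | ∨-zeroʳ (R a) = refl

    originals-clique : ∀ P → allOriginal P ≡ true → IsClique34 W P → IsClique34 (induced G R′) (originals P)
    originals-clique P allP (size , inV , adj) =
      subst (λ l → l ≡ 3 ⊎ l ≡ 4) (sym (length-originals-all P allP)) size ,
      All.tabulate (λ {a} a∈ → let Wa = All.lookup inV (∈-originals P a∈) in
                      ∧-intro (∧-elimˡ (extender-V G R φ W⊆Gφ a Wa)) (Wᵒ⊆R′ a Wa)) ,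
      λ a b a∈ b∈ a≢b →
        let e = adj (a ↑ˡ 4) (b ↑ˡ 4) (∈-originals P a∈) (∈-originals P b∈) (λ eq → a≢b (↑ˡ-injective 4 a b eq))
        in ∧-intro (extender-E G R φ W⊆Gφ a b e)
                   (∧-intro (Wᵒ⊆R′ a (IsGraph.inV w _ _ e)) (Wᵒ⊆R′ b (edge-inVʳ w e)))

    restrict-cliques : ∀ L → All (IsClique34 W) L → All (IsClique34 (induced G R′)) (restrict L)
    restrict-cliques []      _        = []
    restrict-cliques (P ∷ L) (c ∷ cs) with allOriginal P in allP
    ... | true  = originals-clique P allP c ∷ restrict-cliques L cs
    ... | false = restrict-cliques L cs

    identifiedCount≤ : ∀ L → Unique (concat L) → All (IsClique34 W) L → identifiedCount (concat L) ≤ count Wˣ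
    identifiedCount≤ L u cs = ≤-trans
      (countL≤count S (λ p → not (isOriginal p)) (concat L) u
        (All.tabulate (λ {p} p∈ ¬orig → let (P , p∈P , P∈L) = ∈.∈-concat⁻′ L p∈ in
           ∧-intro (All.lookup (proj₁ (proj₂ (All.lookup cs P∈L))) p∈P) ¬orig)))
      (≤-reflexive count-S)
      where
      S : Fin (n + 4) → Bool
      S p = V W p ∧ not (isOriginal p)
      count-S : count S ≡ count Wˣ
      count-S = trans (count-↑ 4 S) (cong₂ _+_
        (count-zero _ (λ a → trans (cong (λ b → Wᵒ a ∧ not b) (isOriginal-↑ˡ a)) (∧-zeroʳ (Wᵒ a))))
        (count-cong (λ i → trans (cong (λ b → Wˣ i ∧ not b) (isOriginal-↑ʳ i)) (∧-identityʳ (Wˣ i)))))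

    T-extension : ∀ {tR tW tR′} → IsT (induced G R) tR → IsT W tW → IsT (induced G R′) tR′ →
                  tR + tW ≤ tR′ + 2 * count Wˣ
    T-extension {tR′ = tR′} ((PR , refl) , _) ((PW , refl) , _) (_ , maxR′) = begin
      partsValue A + partsValue B
        ≤⟨ +-monoʳ-≤ (partsValue A) (partsValue-restrict B (All.map (clique-value≤2 {H = W}) (Packing.cliques PW))) ⟩
      partsValue A + (partsValue (restrict B) + 2 * identifiedCount (concat B))
        ≡⟨ sym (+-assoc (partsValue A) _ _) ⟩
      partsValue A + partsValue (restrict B) + 2 * identifiedCount (concat B)
        ≤⟨ +-mono-≤ (≤-trans (≤-reflexive (sym (partsValue-++ A (restrict B)))) (maxR′ combined))
                    (*-monoʳ-≤ 2 (identifiedCount≤ B (Packing.disjoint PW) (Packing.cliques PW))) ⟩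
      tR′ + 2 * count Wˣ ∎
      where
      open ≤-Reasoning
      A = Packing.parts PR
      B = Packing.parts PW
      disjoint : ∀ {a} → ¬ (a ∈ concat A × a ∈ concat (restrict B))
      disjoint {a} (a∈A , a∈B) =
        let (P , a∈P , P∈A) = ∈.∈-concat⁻′ A a∈A
            (Q , a∈Q , Q∈B) = ∈.∈-concat⁻′ B (∈-restrict B a∈B)
            Ra  = ∧-elimʳ {V G a} (All.lookup (proj₁ (proj₂ (All.lookup (Packing.cliques PR) P∈A))) a∈P)
            Wa  = All.lookup (proj₁ (proj₂ (All.lookup (Packing.cliques PW) Q∈B))) a∈Q
        in case trans (sym (∧-intro Ra Wa)) (R∧Wᵒ≡false a) of λ ()
      combined : Packing (induced G R′)
      combined = record
        { parts    = A ++ restrict B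
        ; disjoint = subst Unique (List.concat-++ A (restrict B))
                       (Unique.++⁺ (Packing.disjoint PR) (restrict-Unique B (Packing.disjoint PW)) disjoint)
        ; cliques  = All.++⁺ (All.map (clique-mono (λ a h → ∧-intro (∧-elimˡ h) (R⊆R′ a (∧-elimʳ {V G a} h)))
                                                    (λ a b h → ∧-intro (∧-elimˡ {E G a b} h)
                                                      (∧-intro (R⊆R′ a (∧-elimˡ (∧-elimʳ {E G a b} h)))
                                                               (R⊆R′ b (∧-elimʳ {R a} (∧-elimʳ {E G a b} h))))) _)
                                      (Packing.cliques PR))
                             (restrict-cliques B (Packing.cliques PW)) }

-- The potential

-- A separate module, since Data.Integer's +_ would make sections such as (x +_) ambiguous elsewhere.
module ℕtoℚ-homomorphism where
  open import Data.Integer using (+_)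
  import Data.Integer.Properties as ℤ

  ℕtoℚᵘ : ℕ → ℚᵘ
  ℕtoℚᵘ v = mkℚᵘ (+ v) 0

  toℚᵘ-ℕtoℚ : ∀ v → toℚᵘ (ℕtoℚ v) ≃ ℕtoℚᵘ v
  toℚᵘ-ℕtoℚ v = ℚ.toℚᵘ-cong (ℚ.normalize-coprime (coprime-sym (1-coprimeTo v)))

  ℕtoℚᵘ-+ : ∀ m n → ℕtoℚᵘ (m + n) ≃ ℕtoℚᵘ m ℚᵘ.+ ℕtoℚᵘ n
  ℕtoℚᵘ-+ m n = *≡* (begin
    + (m + n) ℤ.* + 1                      ≡⟨ ℤ.*-identityʳ _ ⟩
    + (m + n)                              ≡⟨ ℤ.pos-+ m n ⟩
    + m ℤ.+ + n                            ≡⟨ sym (cong₂ ℤ._+_ (ℤ.*-identityʳ (+ m)) (ℤ.*-identityʳ (+ n))) ⟩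
    + m ℤ.* + 1 ℤ.+ + n ℤ.* + 1            ≡⟨ sym (ℤ.*-identityʳ _) ⟩
    (+ m ℤ.* + 1 ℤ.+ + n ℤ.* + 1) ℤ.* + 1  ∎)
    where open ≡-Reasoning

  ℕtoℚᵘ-* : ∀ m n → ℕtoℚᵘ (m * n) ≃ ℕtoℚᵘ m ℚᵘ.* ℕtoℚᵘ n
  ℕtoℚᵘ-* m n = *≡* (begin
    + (m * n) ℤ.* + 1      ≡⟨ ℤ.*-identityʳ _ ⟩
    + (m * n)              ≡⟨ ℤ.pos-* m n ⟩
    + m ℤ.* + n            ≡⟨ sym (ℤ.*-identityʳ _) ⟩
    (+ m ℤ.* + n) ℤ.* + 1  ∎)
    where open ≡-Reasoning

  ℕtoℚ-+ : ∀ m n → ℕtoℚ (m + n) ≡ ℕtoℚ m +ℚ ℕtoℚ n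
  ℕtoℚ-+ m n = ℚ.toℚᵘ-injective (ℚᵘ.≃-trans (toℚᵘ-ℕtoℚ (m + n)) (ℚᵘ.≃-trans (ℕtoℚᵘ-+ m n)
    (ℚᵘ.≃-sym (ℚᵘ.≃-trans (ℚ.toℚᵘ-homo-+ (ℕtoℚ m) (ℕtoℚ n)) (ℚᵘ.+-cong (toℚᵘ-ℕtoℚ m) (toℚᵘ-ℕtoℚ n))))))

  ℕtoℚ-* : ∀ m n → ℕtoℚ (m * n) ≡ ℕtoℚ m *ℚ ℕtoℚ n
  ℕtoℚ-* m n = ℚ.toℚᵘ-injective (ℚᵘ.≃-trans (toℚᵘ-ℕtoℚ (m * n)) (ℚᵘ.≃-trans (ℕtoℚᵘ-* m n)
    (ℚᵘ.≃-sym (ℚᵘ.≃-trans (ℚ.toℚᵘ-homo-* (ℕtoℚ m) (ℕtoℚ n)) (ℚᵘ.*-cong (toℚᵘ-ℕtoℚ m) (toℚᵘ-ℕtoℚ n))))))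

  ℕtoℚ-mono-≤ : ∀ {m n} → m ≤ n → ℕtoℚ m ≤ℚ ℕtoℚ n
  ℕtoℚ-mono-≤ {m} {n} m≤n = ℚ.toℚᵘ-cancel-≤
    (ℚᵘ.≤-respˡ-≃ (ℚᵘ.≃-sym (toℚᵘ-ℕtoℚ m)) (ℚᵘ.≤-respʳ-≃ (ℚᵘ.≃-sym (toℚᵘ-ℕtoℚ n))
      (*≤* (subst₂ ℤ._≤_ (sym (ℤ.*-identityʳ (+ m))) (sym (ℤ.*-identityʳ (+ n))) (ℤ.+≤+ m≤n)))))

open ℕtoℚ-homomorphism using (ℕtoℚ-+; ℕtoℚ-*; ℕtoℚ-mono-≤)

record Census : Set where
  constructor census
  field
    vertices edges packing : ℕ
open Census

census-of : ∀ {n} → Graph n → ℕ → Census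
census-of G t = census (nV G) (nE G) t

-- pot G t reduces to potential (census-of G t).
potential : Census → ℚ
potential c = ((ℕtoℚ 9 +ℚ ε) *ℚ ℕtoℚ (vertices c) -ℚ ℕtoℚ 4 *ℚ ℕtoℚ (edges c)) -ℚ δ *ℚ ℕtoℚ (packing c)

-- Since 21·p = 190|V| − 84|E| − 8T, this says 21·p(a) + k ≤ 21·p(b), with all terms moved to be natural numbers.
record _≤[_]_ (a : Census) (k : ℕ) (b : Census) : Set where
  constructor scaled-gap
  field
    gap : 190 * vertices a + 84 * edges b + 8 * packing b + k ≤ 190 * vertices b + 84 * edges a + 8 * packing a
open _≤[_]_

≤[]-dec : ∀ a k b → Dec (a ≤[ k ] b)
≤[]-dec a k b = map′ scaled-gap gap (_ ≤? _)

≤[0]-packing : ∀ {v e t t′} → t ≤ t′ → census v e t′ ≤[ 0 ] census v e t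
≤[0]-packing {v} {e} {t} t≤t′ = scaled-gap $
  ≤-trans (≤-reflexive (+-identityʳ (190 * v + 84 * e + 8 * t))) (+-monoʳ-≤ (190 * v + 84 * e) (*-monoʳ-≤ 8 t≤t′))

≤[]-weaken : ∀ {a b k l} → l ≤ k → a ≤[ k ] b → a ≤[ l ] b
≤[]-weaken l≤k (scaled-gap a≤b) = scaled-gap (≤-trans (+-monoʳ-≤ _ l≤k) a≤b)

≤[]-trans : ∀ {a b c k l} → a ≤[ k ] b → b ≤[ l ] c → a ≤[ k + l ] c
≤[]-trans {census va ea ta} {census vb eb tb} {census vc ec tc} {k} {l} (scaled-gap a≤b) (scaled-gap b≤c) =
  scaled-gap $ +-cancelʳ-≤ mid _ _ (subst₂ _≤_ (regroupˡ va vb vc ea eb ec ta tb tc k l) (regroupʳ va vb vc ea eb ec ta tb tc)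
                                  (+-mono-≤ a≤b b≤c))
  where
  open ℕ-Solver.+-*-Solver
  mid = 190 * vb + 84 * eb + 8 * tb
  regroupˡ : ∀ va vb vc ea eb ec ta tb tc k l →
    (190 * va + 84 * eb + 8 * tb + k) + (190 * vb + 84 * ec + 8 * tc + l)
      ≡ (190 * va + 84 * ec + 8 * tc + (k + l)) + (190 * vb + 84 * eb + 8 * tb)
  regroupˡ = solve 11 (λ va vb vc ea eb ec ta tb tc k l →
    (con 190 :* va :+ con 84 :* eb :+ con 8 :* tb :+ k) :+ (con 190 :* vb :+ con 84 :* ec :+ con 8 :* tc :+ l)
      := (con 190 :* va :+ con 84 :* ec :+ con 8 :* tc :+ (k :+ l)) :+ (con 190 :* vb :+ con 84 :* eb :+ con 8 :* tb)) refl
  regroupʳ : ∀ va vb vc ea eb ec ta tb tc →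
    (190 * vb + 84 * ea + 8 * ta) + (190 * vc + 84 * eb + 8 * tb)
      ≡ (190 * vc + 84 * ea + 8 * ta) + (190 * vb + 84 * eb + 8 * tb)
  regroupʳ = solve 9 (λ va vb vc ea eb ec ta tb tc →
    (con 190 :* vb :+ con 84 :* ea :+ con 8 :* ta) :+ (con 190 :* vc :+ con 84 :* eb :+ con 8 :* tb)
      := (con 190 :* vc :+ con 84 :* ea :+ con 8 :* ta) :+ (con 190 :* vb :+ con 84 :* eb :+ con 8 :* tb)) refl

instance
  ε-nonNegative : NonNegative ε
  ε-nonNegative = _

scaled : Census → ℕ → ℕ
scaled c k = 190 * vertices c + 84 * edges c + 8 * packing c + k

ℕtoℚ-scaled : ∀ c k → ℕtoℚ (scaled c k) ≡
  ℕtoℚ 190 *ℚ ℕtoℚ (vertices c) +ℚ ℕtoℚ 84 *ℚ ℕtoℚ (edges c) +ℚ ℕtoℚ 8 *ℚ ℕtoℚ (packing c) +ℚ ℕtoℚ k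
ℕtoℚ-scaled (census v e t) k = begin
  ℕtoℚ (190 * v + 84 * e + 8 * t + k)
    ≡⟨ ℕtoℚ-+ (190 * v + 84 * e + 8 * t) k ⟩
  ℕtoℚ (190 * v + 84 * e + 8 * t) +ℚ ℕtoℚ k
    ≡⟨ cong (_+ℚ ℕtoℚ k) (ℕtoℚ-+ (190 * v + 84 * e) (8 * t)) ⟩
  ℕtoℚ (190 * v + 84 * e) +ℚ ℕtoℚ (8 * t) +ℚ ℕtoℚ k
    ≡⟨ cong (λ x → x +ℚ ℕtoℚ (8 * t) +ℚ ℕtoℚ k) (ℕtoℚ-+ (190 * v) (84 * e)) ⟩
  ℕtoℚ (190 * v) +ℚ ℕtoℚ (84 * e) +ℚ ℕtoℚ (8 * t) +ℚ ℕtoℚ k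
    ≡⟨ cong₂ (λ x y → x +ℚ y +ℚ ℕtoℚ k) (cong₂ _+ℚ_ (ℕtoℚ-* 190 v) (ℕtoℚ-* 84 e)) (ℕtoℚ-* 8 t) ⟩
  ℕtoℚ 190 *ℚ ℕtoℚ v +ℚ ℕtoℚ 84 *ℚ ℕtoℚ e +ℚ ℕtoℚ 8 *ℚ ℕtoℚ t +ℚ ℕtoℚ k ∎
  where open ≡-Reasoning

≤[]⇒potential : ∀ {a b k} → a ≤[ k ] b → potential a +ℚ ℕtoℚ k *ℚ ε ≤ℚ potential b
≤[]⇒potential {a@(census va ea ta)} {b@(census vb eb tb)} {k} (scaled-gap a≤b) = begin
  potential a +ℚ ℕtoℚ k *ℚ ε         ≡⟨ shift ⟩
  (potential b +ℚ X *ℚ ε) -ℚ Y *ℚ ε  ≤⟨ ℚ.+-monoˡ-≤ (ℚ.- (Y *ℚ ε)) (ℚ.+-monoʳ-≤ (potential b) (ℚ.*-monoʳ-≤-nonNeg ε X≤Y)) ⟩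
  (potential b +ℚ Y *ℚ ε) -ℚ Y *ℚ ε  ≡⟨ cancel ⟩
  potential b                        ∎
  where
  open ℚ.≤-Reasoning
  open ℚ-Solver.+-*-Solver
  X = ℕtoℚ 190 *ℚ ℕtoℚ va +ℚ ℕtoℚ 84 *ℚ ℕtoℚ eb +ℚ ℕtoℚ 8 *ℚ ℕtoℚ tb +ℚ ℕtoℚ k
  Y = ℕtoℚ 190 *ℚ ℕtoℚ vb +ℚ ℕtoℚ 84 *ℚ ℕtoℚ ea +ℚ ℕtoℚ 8 *ℚ ℕtoℚ ta +ℚ ℕtoℚ 0
  X≤Y : X ≤ℚ Y
  X≤Y = subst₂ _≤ℚ_ (ℕtoℚ-scaled (census va eb tb) k) (ℕtoℚ-scaled (census vb ea ta) 0)
          (ℕtoℚ-mono-≤ (subst (scaled (census va eb tb) k ≤_) (sym (+-identityʳ (190 * vb + 84 * ea + 8 * ta))) a≤b))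
  shift : potential a +ℚ ℕtoℚ k *ℚ ε ≡ (potential b +ℚ X *ℚ ε) -ℚ Y *ℚ ε
  shift = solve 7 (λ va ea ta vb eb tb k →
    ((con (ℕtoℚ 9 +ℚ ε) :* va :- con (ℕtoℚ 4) :* ea) :- con δ :* ta) :+ k :* con ε
    := ((((con (ℕtoℚ 9 +ℚ ε) :* vb :- con (ℕtoℚ 4) :* eb) :- con δ :* tb)
         :+ (con (ℕtoℚ 190) :* va :+ con (ℕtoℚ 84) :* eb :+ con (ℕtoℚ 8) :* tb :+ k) :* con ε)
       :- (con (ℕtoℚ 190) :* vb :+ con (ℕtoℚ 84) :* ea :+ con (ℕtoℚ 8) :* ta :+ con (ℕtoℚ 0)) :* con ε))
    refl (ℕtoℚ va) (ℕtoℚ ea) (ℕtoℚ ta) (ℕtoℚ vb) (ℕtoℚ eb) (ℕtoℚ tb) (ℕtoℚ k)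
  cancel : (potential b +ℚ Y *ℚ ε) -ℚ Y *ℚ ε ≡ potential b
  cancel = solve 2 (λ p y → (p :+ y :* con ε) :- y :* con ε := p) refl (potential b) Y

potential≤94/21 : ∀ c → potential c ≤ℚ ℕtoℚ 94 *ℚ ε →
                  190 * vertices c ≤ 94 + 84 * edges c + 8 * packing c
potential≤94/21 c@(census v e t) p≤ with 190 * v ≤? 94 + 84 * e + 8 * t
... | yes bound = bound
... | no  ¬bound = ⊥-elim (ℚ.<-irrefl refl (ℚ.<-≤-trans 94/21<95/21 (ℚ.≤-trans (≤[]⇒potential 0≤[95]c) p≤)))
  where
  0≤[95]c : census 0 0 0 ≤[ 95 ] c
  0≤[95]c = scaled-gap $ subst₂ _≤_ (+-comm 95 (84 * e + 8 * t)) (sym (trans (+-identityʳ (190 * v + 0)) (+-identityʳ (190 * v))))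
              (≰⇒> ¬bound)
  94/21<95/21 : ℕtoℚ 94 *ℚ ε ℚ.< ℕtoℚ 95 *ℚ ε
  94/21<95/21 = toWitness {a? = ℕtoℚ 94 *ℚ ε ℚ.<? ℕtoℚ 95 *ℚ ε} tt

oreBound≤94/21 : ∀ v → (ℕtoℚ 5 +ℚ ℕtoℚ v *ℚ ε) -ℚ (ℕtoℚ 2 +ℚ (ℕtoℚ v -ℚ 1ℚ) *ℚ (ℤ.+ 1 ℚ./ 4)) *ℚ δ
                       ≤ℚ ℕtoℚ 94 *ℚ ε
oreBound≤94/21 v = begin
  B                  ≡⟨ solve 1 (λ B → B := B :+ con 0ℚ) refl B ⟩
  B +ℚ 0ℚ            ≤⟨ ℚ.+-monoʳ-≤ B (ℚ.*-monoʳ-≤-nonNeg ε (ℕtoℚ-mono-≤ {0} {v} z≤n)) ⟩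
  B +ℚ ℕtoℚ v *ℚ ε   ≡⟨ v-cancels ⟩
  ℕtoℚ 91 *ℚ ε       ≤⟨ toWitness {a? = ℕtoℚ 91 *ℚ ε ℚ.≤? ℕtoℚ 94 *ℚ ε} tt ⟩
  ℕtoℚ 94 *ℚ ε       ∎
  where
  open ℚ.≤-Reasoning
  open ℚ-Solver.+-*-Solver
  B = (ℕtoℚ 5 +ℚ ℕtoℚ v *ℚ ε) -ℚ (ℕtoℚ 2 +ℚ (ℕtoℚ v -ℚ 1ℚ) *ℚ (ℤ.+ 1 ℚ./ 4)) *ℚ δ
  v-cancels : B +ℚ ℕtoℚ v *ℚ ε ≡ ℕtoℚ 91 *ℚ ε
  v-cancels = solve 1 (λ v →
    (con (ℕtoℚ 5) :+ v :* con ε) :- (con (ℕtoℚ 2) :+ (v :- con 1ℚ) :* con (ℤ.+ 1 ℚ./ 4)) :* con δ :+ v :* con ε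
      := con (ℕtoℚ 91) :* con ε) refl (ℕtoℚ v)

-- Every case of the Main Theorem gives 21·p(H) ≤ 94.
main-theorem-bound : ∀ {m} {H : Graph m} {t} → MainThm H → IsT H t → 190 * nV H ≤ 94 + 84 * nE H + 8 * t
main-theorem-bound {H = H} {t} main T = decidable-stable (_ ≤? _) do
  iso? ← ¬¬-excluded-middle
  ore? ← ¬¬-excluded-middle
  pure (potential≤94/21 (census-of H t) (bound iso? ore?))
  where
  bound : Dec (Iso H K5) → Dec (Ore5 H) → pot H t ≤ℚ ℕtoℚ 94 *ℚ ε
  bound (yes iso) _         = ℚ.≤-reflexive (proj₁ (main t T) iso)
  bound (no ¬iso) (yes ore) = ℚ.≤-trans (proj₁ (proj₂ (main t T)) ore ¬iso) (oreBound≤94/21 (nV H))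
  bound (no ¬iso) (no ¬ore) = ℚ.≤-trans (proj₂ (proj₂ (main t T)) ¬ore)
                                (toWitness {a? = ℕtoℚ 5 -ℚ Pc ℚ.≤? ℕtoℚ 94 *ℚ ε} tt)

≤[80]⇒potential : ∀ {a b} → a ≤[ 80 ] b → ((potential a +ℚ ℕtoℚ 4) -ℚ δ) +ℚ ℕtoℚ 4 *ℚ ε ≤ℚ potential b
≤[80]⇒potential {a} {b} a≤b = ℚ.≤-trans (ℚ.≤-reflexive (solve 1 (λ p →
  ((p :+ con (ℕtoℚ 4)) :- con δ) :+ con (ℕtoℚ 4) :* con ε := p :+ con (ℕtoℚ 80) :* con ε) refl (potential a)))
  (≤[]⇒potential a≤b)
  where open ℚ-Solver.+-*-Solver

≤[0]⇒potential : ∀ {a b} → a ≤[ 0 ] b → potential a ≤ℚ potential b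
≤[0]⇒potential {a} {b} a≤b = ℚ.≤-trans (ℚ.≤-reflexive (solve 1 (λ p → p := p :+ con (ℕtoℚ 0) :* con ε) refl (potential a)))
  (≤[]⇒potential a≤b)
  where open ℚ-Solver.+-*-Solver

-- Critical extensions

decide : ∀ {a b} {_ : True (a ≤? b)} → a ≤ b
decide {_} {_} {a≤b} = toWitness a≤b

identified-vertices-bound : ∀ (f : Fin 4 → Bool) → anyF f ≡ true →
                            42 * orderedPairs f + 16 * count f + 174 ≤ 190 * count f
identified-vertices-bound f any-f with f zero | f (suc zero) | f (suc (suc zero)) | f (suc (suc (suc zero)))
... | false | false | false | false with any-f
...   | ()
identified-vertices-bound f _ | true  | true  | true  | true  = decide
identified-vertices-bound f _ | true  | true  | true  | false = decide
identified-vertices-bound f _ | true  | true  | false | true  = decide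
identified-vertices-bound f _ | true  | true  | false | false = decide
identified-vertices-bound f _ | true  | false | true  | true  = decide
identified-vertices-bound f _ | true  | false | true  | false = decide
identified-vertices-bound f _ | true  | false | false | true  = decide
identified-vertices-bound f _ | true  | false | false | false = decide
identified-vertices-bound f _ | false | true  | true  | true  = decide
identified-vertices-bound f _ | false | true  | true  | false = decide
identified-vertices-bound f _ | false | true  | false | true  = decide
identified-vertices-bound f _ | false | true  | false | false = decide
identified-vertices-bound f _ | false | false | true  | true  = decide
identified-vertices-bound f _ | false | false | true  | false = decide
identified-vertices-bound f _ | false | false | false | true  = decide

-- Weights: 42 × edge bound, 8 × packing bound, plus 21·p(W) ≤ 94 and the bound on identified vertices.
extension-inequality : ∀ vR vR′ o vW eR eR′ eW tR tR′ tW x xx → vR′ ≡ vR + o → vW ≡ o + x →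
  eR + eR + (eW + eW) ≤ eR′ + eR′ + xx → tR + tW ≤ tR′ + 2 * x →
  190 * vW ≤ 94 + 84 * eW + 8 * tW → 42 * xx + 16 * x + 174 ≤ 190 * x →
  census vR′ eR′ tR′ ≤[ 80 ] census vR eR tR
extension-inequality vR vR′ o vW eR eR′ eW tR tR′ tW x xx refl refl edges packings W-bound x-bound = scaled-gap $
  +-cancelʳ-≤ Z _ _ (subst₂ _≤_ (sym lhs) (sym rhs) (+-monoʳ-≤ (190 * vR) combined))
  where
  open ℕ-Solver.+-*-Solver
  Z = 84 * eW + 8 * tW + 190 * x + 42 * xx + 16 * x + 94
  combined : 42 * (eR + eR + (eW + eW)) + 8 * (tR + tW) + 190 * (o + x) + (42 * xx + 16 * x + 174)
             ≤ 42 * (eR′ + eR′ + xx) + 8 * (tR′ + 2 * x) + (94 + 84 * eW + 8 * tW) + 190 * x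
  combined = +-mono-≤ (+-mono-≤ (+-mono-≤ (*-monoʳ-≤ 42 edges) (*-monoʳ-≤ 8 packings)) W-bound) x-bound
  lhs : 190 * (vR + o) + 84 * eR + 8 * tR + 80 + Z ≡
        190 * vR + (42 * (eR + eR + (eW + eW)) + 8 * (tR + tW) + 190 * (o + x) + (42 * xx + 16 * x + 174))
  lhs = solve 8 (λ vR o eR eW tR tW x xx →
    con 190 :* (vR :+ o) :+ con 84 :* eR :+ con 8 :* tR :+ con 80
      :+ (con 84 :* eW :+ con 8 :* tW :+ con 190 :* x :+ con 42 :* xx :+ con 16 :* x :+ con 94)
    := con 190 :* vR :+ (con 42 :* (eR :+ eR :+ (eW :+ eW)) :+ con 8 :* (tR :+ tW) :+ con 190 :* (o :+ x)
                         :+ (con 42 :* xx :+ con 16 :* x :+ con 174)))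
    refl vR o eR eW tR tW x xx
  rhs : 190 * vR + 84 * eR′ + 8 * tR′ + Z ≡
        190 * vR + (42 * (eR′ + eR′ + xx) + 8 * (tR′ + 2 * x) + (94 + 84 * eW + 8 * tW) + 190 * x)
  rhs = solve 7 (λ vR eR′ eW tR′ tW x xx →
    con 190 :* vR :+ con 84 :* eR′ :+ con 8 :* tR′
      :+ (con 84 :* eW :+ con 8 :* tW :+ con 190 :* x :+ con 42 :* xx :+ con 16 :* x :+ con 94)
    := con 190 :* vR :+ (con 42 :* (eR′ :+ eR′ :+ xx) :+ con 8 :* (tR′ :+ con 2 :* x)
                         :+ (con 94 :+ con 84 :* eW :+ con 8 :* tW) :+ con 190 :* x))
    refl vR eR′ eW tR′ tW x xx

critical-extension-drop : ∀ {n} {G : Graph n} → IsGraph G → Good G →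
  (R : Fin n → Bool) → (∀ v → R v ≡ true → V G v ≡ true) → 5 ≤ count R →
  (R′ : Fin n → Bool) → CriticalExtension G R R′ →
  ∀ {tR tR′} → IsT (induced G R) tR → IsT (induced G R′) tR′ →
  census-of (induced G R′) tR′ ≤[ 80 ] census-of (induced G R) tR
critical-extension-drop {n} {G} g (G-critical , smaller-main) R R⊆V 5≤R R′
                        (φ , _ , W , W⊆Gφ , W-critical , R′≡) {tR} {tR′} TR TR′ =
  decidable-stable (≤[]-dec _ _ _) do
    (tW , TW) ← ¬¬-T W
    pure (extension-inequality (nV (induced G R)) (nV (induced G R′)) (count Wᵒ) (nV W)
            (nE (induced G R)) (nE (induced G R′)) (nE W) tR tR′ tW (count Wˣ) (orderedPairs Wˣ) (nV-R′ R′≡) nV-W (nE-R′ R′≡)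
            (T-extension R′≡ TR TW TR′) (main-theorem-bound W-main TW)
            (identified-vertices-bound Wˣ meets-identified))
  where
  open Extender g R φ W⊆Gφ
  r∈R = count-positive R (≤-trans (s≤s z≤n) 5≤R)
  r = proj₁ r∈R
  meets-identified : anyF Wˣ ≡ true
  meets-identified = extender-meets-identified W⊆Gφ W-critical (Critical5.sub4col G-critical)
    (r , R⊆V r (proj₂ r∈R) , subst (λ b → b ∧ Wᵒ r ≡ false) (proj₂ r∈R) (R∧Wᵒ≡false r))
  W-smaller : nV W < nV G
  W-smaller = begin-strict
    nV W                     ≡⟨ nV-W ⟩
    count Wᵒ + count Wˣ      ≤⟨ +-monoʳ-≤ (count Wᵒ) (count≤n Wˣ) ⟩
    count Wᵒ + 4             <⟨ +-monoʳ-< (count Wᵒ) (n<1+n 4) ⟩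
    count Wᵒ + 5             ≤⟨ +-monoʳ-≤ (count Wᵒ) 5≤R ⟩
    count Wᵒ + count R       ≡⟨ +-comm (count Wᵒ) (count R) ⟩
    count R + count Wᵒ       ≡⟨ sym (count-∨ R Wᵒ R∧Wᵒ≡false) ⟩
    count (λ a → R a ∨ Wᵒ a) ≤⟨ count-mono (R∨Wᵒ⊆V R⊆V) ⟩
    nV G                     ∎
    where open ≤-Reasoning
  W-main : MainThm W
  W-main = smaller-main (n + 4) W (Subgraph.wf W⊆Gφ) W-critical (inj₁ W-smaller)

whole-graph-minimizes-potential : ∀ {n} {G : Graph n} → IsGraph G → Good G → ∀ {tG} → IsT G tG →
  (S : Fin n → Bool) → (∀ v → S v ≡ true → V G v ≡ true) → 5 ≤ count S →
  ∀ {tS} → IsT (induced G S) tS → census-of G tG ≤[ 0 ] census-of (induced G S) tS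
whole-graph-minimizes-potential {n} {G} g good@(G-critical , _) {tG} TG S S⊆V 5≤S TS =
  decidable-stable (≤[]-dec _ _ _) (grow n S (m≤n+m n (count S)) S⊆V 5≤S TS)
  where
  grow : ∀ gap S → n ≤ count S + gap → (∀ v → S v ≡ true → V G v ≡ true) → 5 ≤ count S →
         ∀ {tS} → IsT (induced G S) tS → ¬ ¬ (census-of G tG ≤[ 0 ] census-of (induced G S) tS)
  grow-cases : ∀ gap S → n ≤ count S + gap → (∀ v → S v ≡ true → V G v ≡ true) → 5 ≤ count S →
               ∀ {tS} → IsT (induced G S) tS →
               (∀ v → V G v ≡ true → S v ≡ true) ⊎ Σ (Fin n) (λ v → V G v ≡ true × S v ≡ false) →
               ¬ ¬ (census-of G tG ≤[ 0 ] census-of (induced G S) tS)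
  grow gap S n≤S+gap S⊆V 5≤S TS = grow-cases gap S n≤S+gap S⊆V 5≤S TS (covers-or-misses G S)
  grow-cases gap S n≤S+gap S⊆V 5≤S {tS} TS (inj₁ V⊆S) =
    pure (subst (_≤[ 0 ] census-of (induced G S) tS)
                (cong₂ (λ v e → census v e tG) (nV-spanning g V⊆S) (nE-spanning g V⊆S))
                (≤[0]-packing (T-mono (λ _ h → ∧-elimˡ h) (λ i j h → ∧-elimˡ {E G i j} h) TS TG)))
  grow-cases gap S n≤S+gap S⊆V 5≤S {tS} TS (inj₂ (v , Gv , Sv)) = do
      (W , W⊆Gφ , W-critical) ← ¬¬-critical-subgraph (Gφ-isGraph g S φ)
                                   (Gφ-not4colorable g S φ φ-proper (Critical5.not4col G-critical))
      let open Extender g S φ W⊆Gφ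
          S′ = λ a → S a ∨ Wᵒ a
          S<S′ = R<R∨Wᵒ W-critical
      (tS′ , TS′) ← ¬¬-T (induced G S′)
      G≤S′ ← recurse gap n≤S+gap S<S′ (R∨Wᵒ⊆V S⊆V) (≤-trans 5≤S (<⇒≤ S<S′)) TS′
      pure (≤[]-weaken z≤n (≤[]-trans G≤S′
             (critical-extension-drop g good S S⊆V 5≤S S′ (φ , φ-proper , W , W⊆Gφ , W-critical , λ _ → refl) TS TS′)))
    where
    φ,φ-proper = Critical5.sub4col G-critical (induced G S) (induced-⊂ S g v Gv Sv)
    φ = proj₁ φ,φ-proper
    φ-proper = proj₂ φ,φ-proper
    recurse : ∀ gap {S′} → n ≤ count S + gap → count S < count S′ → (∀ v → S′ v ≡ true → V G v ≡ true) →
              5 ≤ count S′ → ∀ {tS′} → IsT (induced G S′) tS′ →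
              ¬ ¬ (census-of G tG ≤[ 0 ] census-of (induced G S′) tS′)
    recurse zero      {S′} n≤S S<S′ =
      ⊥-elim (<-irrefl refl (<-≤-trans S<S′ (≤-trans (count≤n S′) (subst (n ≤_) (+-identityʳ (count S)) n≤S))))
    recurse (suc gap) {S′} n≤S+1+gap S<S′ =
      grow gap S′ (≤-trans n≤S+1+gap (subst (_≤ count S′ + gap) (sym (+-suc (count S) gap)) (+-monoˡ-≤ gap S<S′)))

lemma4p3 : ∀ {n} (G : Graph n) → IsGraph G → Good G →
    (R : Fin n → Bool) →
    (∀ v → R v ≡ true → V G v ≡ true) →
    Σ (Fin n) (λ v → V G v ≡ true × R v ≡ false) →
    5 ≤ count R →
    (R' : Fin n → Bool) → CriticalExtension G R R' →
    ∀ tR tR' tG → IsT (induced G R) tR → IsT (induced G R') tR' → IsT G tG →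
    (((pot (induced G R') tR' +ℚ ℕtoℚ 4) -ℚ δ) +ℚ ℕtoℚ 4 *ℚ ε ≤ℚ pot (induced G R) tR) ×
    (pot G tG ≤ℚ pot (induced G R') tR') ×
    (((pot G tG +ℚ ℕtoℚ 4) -ℚ δ) +ℚ ℕtoℚ 4 *ℚ ε ≤ℚ pot (induced G R) tR)
lemma4p3 G g good R R⊆V _ 5≤R R′ ext@(φ , _ , W , W⊆Gφ , _ , R′≡) tR tR′ tG TR TR′ TG =
    ≤[80]⇒potential R′-drop
  , ≤[0]⇒potential G-minimal
  , ≤[80]⇒potential (≤[]-trans G-minimal R′-drop)
  where
  open Extender g R φ W⊆Gφ
  R′⊆V : ∀ v → R′ v ≡ true → V G v ≡ true
  R′⊆V v h = R∨Wᵒ⊆V R⊆V v (trans (sym (R′≡ v)) h)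
  R′-drop = critical-extension-drop g good R R⊆V 5≤R R′ ext TR TR′
  G-minimal = whole-graph-minimizes-potential g good TG R′ R′⊆V (≤-trans 5≤R (count-mono (R⊆R′ R′≡))) TR′
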